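{- Let $r,s,j$ be nonnegative integers with $j\le r$. Then $$X_+^{\,r+s-j}\,Y_+^{\,r-j}\,m_{1^j}(\mathbf{xy})\Big|_{\mathbf y=\mathbf x}=\sum_{j\le i\le r}\binom{i}{j}\binom{2(r-i)+s}{r-i}(r-j)!\,(r+s-j)!\;m_{2^i1^{2(r-i)+s}}(\mathbf x).$$
   Context: $\mathbf x=(x_1,x_2,\dots)$, $\mathbf y=(y_1,y_2,\dots)$ are alphabets of variables and $\mathbf{xy}=(x_1y_1,x_2y_2,\dots)$. $m_\mu$ denotes the monomial symmetric function indexed by the partition $\mu$; $2^i1^k$ is the partition with $i$ parts equal to $2$ and $k$ parts equal to $1$. The operators are $X_+=\sum_{i\ge1}\left(x_i-x_i^2\frac{\partial}{\partial x_i}\right)$ and $Y_+=\sum_{i\ge1}\left(y_i-y_i^2\frac{\partial}{\partial y_i}\right)$. -}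

module Defs where

-- Polynomials with integer coefficients in k commuting variables, represented
-- as finite formal sums (lists) of terms  c · x^e  with exponent vector e.

open import Data.Nat as ℕ using (ℕ; zero; suc; _∸_; _!; _≤_)
open import Data.Nat.Combinatorics using (_C_)
open import Data.Integer as ℤ using (ℤ; +_; -_)
open import Data.Fin as Fin using (Fin)
open import Data.Vec as Vec using (Vec; []; _∷_; _[_]%=_; lookup; zipWith; take; drop)
open import Data.Vec.Properties using (≡-dec)
open import Data.List as List using (List; []; _∷_; _++_; map; concatMap; filter; foldr)
open import Data.Product using (_×_; _,_)
open import Relation.Nullary using (yes; no)
open import Relation.Nullary.Decidable using (_×-dec_)
open import Relation.Binary.PropositionalEquality using (_≡_)

Poly : ℕ → Set
Poly k = List (ℤ × Vec ℕ k)

coeff : ∀ {k} → Poly k → Vec ℕ k → ℤ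
coeff [] e = + 0
coeff ((c , e′) ∷ p) e with ≡-dec ℕ._≟_ e′ e
... | yes _ = c ℤ.+ coeff p e
... | no  _ = coeff p e

infix 4 _≈P_
_≈P_ : ∀ {k} → Poly k → Poly k → Set
p ≈P q = ∀ e → coeff p e ≡ coeff q e

scale : ∀ {k} → ℤ → Poly k → Poly k
scale a = map (λ { (c , e) → (a ℤ.* c , e) })

neg : ∀ {k} → Poly k → Poly k
neg = scale (- (+ 1))

mulVar : ∀ {k} → Fin k → Poly k → Poly k
mulVar i = map (λ { (c , e) → (c , e [ i ]%= suc) })

deriv : ∀ {k} → Fin k → Poly k → Poly k
deriv i = map (λ { (c , e) → (c ℤ.* (+ lookup e i) , e [ i ]%= ℕ.pred) })

raiseOp : ∀ {k} → Fin k → Poly k → Poly k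
raiseOp i p = mulVar i p ++ neg (mulVar i (mulVar i (deriv i p)))

-- Polynomials in the two alphabets x = (x_1..x_n), y = (y_1..y_n):
-- variables 0..n-1 are x_1..x_n, variables n..2n-1 are y_1..y_n.

Xplus : ∀ n → Poly (n ℕ.+ n) → Poly (n ℕ.+ n)
Xplus n p = concatMap (λ i → raiseOp (i Fin.↑ˡ n) p) (List.allFin n)

Yplus : ∀ n → Poly (n ℕ.+ n) → Poly (n ℕ.+ n)
Yplus n p = concatMap (λ i → raiseOp (n Fin.↑ʳ i) p) (List.allFin n)

iter : ∀ {A : Set} → ℕ → (A → A) → A → A
iter zero f a = a
iter (suc m) f a = f (iter m f a)

allVecs : List ℕ → ∀ n → List (Vec ℕ n)
allVecs vals zero = [] ∷ []
allVecs vals (suc n) = concatMap (λ a → map (a ∷_) (allVecs vals n)) vals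

count : ∀ {n} → ℕ → Vec ℕ n → ℕ
count a [] = 0
count a (b ∷ v) with a ℕ.≟ b
... | yes _ = suc (count a v)
... | no  _ = count a v

m21 : ∀ n → ℕ → ℕ → Poly n
m21 n i k =
  map (λ e → (+ 1 , e))
      (filter (λ e → (count 2 e ℕ.≟ i) ×-dec (count 1 e ℕ.≟ k))
              (allVecs (0 ∷ 1 ∷ 2 ∷ []) n))

-- m_{1^j}(xy) = Σ_{t_1<…<t_j} (x_{t_1}y_{t_1})⋯(x_{t_j}y_{t_j}) in the 2n variables
m1xy : ∀ n → ℕ → Poly (n ℕ.+ n)
m1xy n j =
  map (λ e → (+ 1 , e Vec.++ e))
      (filter (λ e → count 1 e ℕ.≟ j) (allVecs (0 ∷ 1 ∷ []) n))

diag : ∀ n → Poly (n ℕ.+ n) → Poly n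
diag n = map (λ { (c , e) → (c , zipWith ℕ._+_ (take n e) (drop n e)) })

lhs : ∀ n (r s j : ℕ) → Poly n
lhs n r s j =
  diag n (iter ((r ℕ.+ s) ∸ j) (Xplus n) (iter (r ∸ j) (Yplus n) (m1xy n j)))

rhs : ∀ n (r s j : ℕ) → Poly n
rhs n r s j =
  concatMap
    (λ t → let i = j ℕ.+ t in
       scale (+ ((i C j) ℕ.* ((2 ℕ.* (r ∸ i) ℕ.+ s) C (r ∸ i))
                 ℕ.* (r ∸ j) ! ℕ.* ((r ℕ.+ s) ∸ j) !))
             (m21 n i (2 ℕ.* (r ∸ i) ℕ.+ s)))
    (List.upTo (suc (r ∸ j)))

module Submission where

-- Since (x − x²∂)x^{a−1} = (2 − a)x^a, the operator
-- X_+ kills every monomial into which it would introduce a square, so it sends the sum of the squarefree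
-- monomials of degree m divisible by x^c to m + 1 − |c| times the corresponding sum in degree m + 1. Expanding
-- m_{1^j}(xy) = Σ_{|c| = j} x^c y^c, this gives
--   X_+^{r+s−j} Y_+^{r−j} m_{1^j}(xy) = (r−j)! (r+s−j)! Σ_{|c| = j} Σ x^a y^b,
-- the inner sum running over squarefree x^a, y^b of degrees r+s and r divisible by x^c, y^c.
-- After y = x, the coefficient of x^e counts the factorizations x^e = x^a x^b together with a
-- j-subset c of the variables common to x^a and x^b. If e has i entries 2, k entries 1 and no
-- larger entries, these variables are the i squared ones, so the count is C(i, j) C(k, r − i) with
-- k = 2(r − i) + s; multiplied by (r−j)! (r+s−j)! this is the coefficient of m_{2^i 1^k} on the right.

open import Defs
open import Data.Nat as ℕ using (ℕ; zero; suc; _∸_; _!; _≤_; _<_; z≤n; s≤s)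
import Data.Nat.Properties as ℕₚ
open import Data.Nat.Combinatorics using (_C_; nCn≡1; nCk+nC[k+1]≡[n+1]C[k+1]; nCk≡nC[n∸k]; k>n⇒nCk≡0)
open import Data.Integer as ℤ using (ℤ; +_; -_; _+_; _*_; 0ℤ; 1ℤ)
open import Data.Integer.Properties
open import Data.Integer.Tactic.RingSolver using (solve-∀)
open import Data.Fin as Fin using (Fin)
open import Data.Vec as Vec using (Vec; []; _∷_; _[_]%=_; lookup; zipWith; take; drop)
import Data.Vec.Properties as Vecₚ
open import Data.List as List using (List; []; _∷_; _++_; map; concatMap; filter)
import Data.List.Properties as Listₚ
open import Data.Product using (_×_; _,_; proj₂)
open import Relation.Nullary using (yes; no; Dec)
open import Relation.Nullary.Decidable using (_×-dec_)
open import Relation.Binary.PropositionalEquality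
open import Data.Empty using (⊥-elim)
open import Data.Sum as Sum using (_⊎_; inj₁; inj₂)
open import Function using (_∘_; id)

private variable
  A B : Set
  k n : ℕ

∑ : List A → (A → ℤ) → ℤ
∑ []       f = 0ℤ
∑ (x ∷ xs) f = f x + ∑ xs f

syntax ∑ xs (λ x → f) = ∑[ x ∈ xs ] f

∑-cong : ∀ (xs : List A) {f g : A → ℤ} → (∀ x → f x ≡ g x) → ∑ xs f ≡ ∑ xs g
∑-cong []       f≗g = refl
∑-cong (x ∷ xs) f≗g = cong₂ _+_ (f≗g x) (∑-cong xs f≗g)

∑-zero : ∀ (xs : List A) {f : A → ℤ} → (∀ x → f x ≡ 0ℤ) → ∑ xs f ≡ 0ℤ
∑-zero []       f≗0 = refl
∑-zero (x ∷ xs) f≗0 = cong₂ _+_ (f≗0 x) (∑-zero xs f≗0)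

∑-++ : ∀ (xs ys : List A) f → ∑ (xs ++ ys) f ≡ ∑ xs f + ∑ ys f
∑-++ []       ys f = sym (+-identityˡ _)
∑-++ (x ∷ xs) ys f = trans (cong (_+_ (f x)) (∑-++ xs ys f)) (sym (+-assoc (f x) _ _))

∑-map : ∀ (g : A → B) (xs : List A) f → ∑ (map g xs) f ≡ ∑[ x ∈ xs ] f (g x)
∑-map g []       f = refl
∑-map g (x ∷ xs) f = cong (_+_ (f (g x))) (∑-map g xs f)

∑-concatMap : ∀ (g : A → List B) (xs : List A) f →
              ∑ (concatMap g xs) f ≡ ∑[ x ∈ xs ] ∑ (g x) f
∑-concatMap g []       f = refl
∑-concatMap g (x ∷ xs) f =
  trans (∑-++ (g x) (concatMap g xs) f) (cong (_+_ (∑ (g x) f)) (∑-concatMap g xs f))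

∑-+ : ∀ (xs : List A) f g → ∑[ x ∈ xs ] (f x + g x) ≡ ∑ xs f + ∑ xs g
∑-+ []       f g = refl
∑-+ (x ∷ xs) f g = trans (cong (_+_ (f x + g x)) (∑-+ xs f g)) (interchange (f x) (g x) _ _)
  where
  interchange : ∀ a b c d → a + b + (c + d) ≡ a + c + (b + d)
  interchange = solve-∀

∑-*ˡ : ∀ (xs : List A) c f → ∑[ x ∈ xs ] (c * f x) ≡ c * ∑ xs f
∑-*ˡ []       c f = sym (*-zeroʳ c)
∑-*ˡ (x ∷ xs) c f = trans (cong (_+_ (c * f x)) (∑-*ˡ xs c f)) (sym (*-distribˡ-+ c (f x) _))

∑-swap : ∀ (xs : List A) (ys : List B) (f : A → B → ℤ) →
         ∑[ x ∈ xs ] ∑[ y ∈ ys ] f x y ≡ ∑[ y ∈ ys ] ∑[ x ∈ xs ] f x y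
∑-swap []       ys f = sym (∑-zero ys (λ _ → refl))
∑-swap (x ∷ xs) ys f =
  trans (cong (_+_ (∑ ys (f x))) (∑-swap xs ys f)) (sym (∑-+ ys (f x) (λ y → ∑[ x′ ∈ xs ] f x′ y)))

𝟙 : {P : Set} → Dec P → ℤ
𝟙 (yes _) = 1ℤ
𝟙 (no  _) = 0ℤ

𝟙-×-dec : {P Q : Set} (P? : Dec P) (Q? : Dec Q) → 𝟙 (P? ×-dec Q?) ≡ 𝟙 P? * 𝟙 Q?
𝟙-×-dec (yes _) (yes _) = refl
𝟙-×-dec (yes _) (no  _) = refl
𝟙-×-dec (no  _) Q?      = refl

∑-filter : ∀ {P : A → Set} (P? : ∀ x → Dec (P x)) (xs : List A) f →
           ∑ (filter P? xs) f ≡ ∑[ x ∈ xs ] (𝟙 (P? x) * f x)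
∑-filter P? []       f = refl
∑-filter P? (x ∷ xs) f with P? x
... | yes _ = cong₂ _+_ (sym (*-identityˡ (f x))) (∑-filter P? xs f)
... | no  _ = trans (∑-filter P? xs f) (sym (+-identityˡ _))

∑-upTo-suc : ∀ m (f : ℕ → ℤ) → ∑ (List.upTo (suc m)) f ≡ f 0 + ∑[ t ∈ List.upTo m ] f (suc t)
∑-upTo-suc m f =
  cong (_+_ (f 0)) (trans (cong (λ ts → ∑ ts f) (sym (Listₚ.map-upTo suc m))) (∑-map suc (List.upTo m) f))

∑-upTo-zero : ∀ m (f : ℕ → ℤ) → (∀ t → t < m → f t ≡ 0ℤ) → ∑ (List.upTo m) f ≡ 0ℤ
∑-upTo-zero zero    f f≡0 = refl
∑-upTo-zero (suc m) f f≡0 = trans (∑-upTo-suc m f)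
  (cong₂ _+_ (f≡0 0 (s≤s z≤n)) (∑-upTo-zero m (f ∘ suc) λ t t<m → f≡0 (suc t) (s≤s t<m)))

∑-upTo-single : ∀ m (f : ℕ → ℤ) x → x < m → (∀ t → t < m → t ≢ x → f t ≡ 0ℤ) → ∑ (List.upTo m) f ≡ f x
∑-upTo-single (suc m) f zero    x<m f≡0 = trans (∑-upTo-suc m f) (trans
  (cong (_+_ (f 0)) (∑-upTo-zero m (f ∘ suc) λ t t<m → f≡0 (suc t) (s≤s t<m) λ ())) (+-identityʳ (f 0)))
∑-upTo-single (suc m) f (suc x) (s≤s x<m) f≡0 = trans (∑-upTo-suc m f) (trans
  (cong₂ _+_ (f≡0 0 (s≤s z≤n) λ ())
             (∑-upTo-single m (f ∘ suc) x x<m λ t t<m t≢x → f≡0 (suc t) (s≤s t<m) (t≢x ∘ ℕₚ.suc-injective)))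
  (+-identityˡ (f (suc x))))

∑-allVecs-suc : ∀ vals n (f : Vec ℕ (suc n) → ℤ) →
                ∑ (allVecs vals (suc n)) f ≡ ∑[ x ∈ vals ] ∑[ v ∈ allVecs vals n ] f (x ∷ v)
∑-allVecs-suc vals n f = trans (∑-concatMap _ vals f) (∑-cong vals λ x → ∑-map (x ∷_) (allVecs vals n) f)

δ : ℕ → ℕ → ℤ
δ zero    zero    = 1ℤ
δ zero    (suc _) = 0ℤ
δ (suc _) zero    = 0ℤ
δ (suc x) (suc y) = δ x y

δ-refl : ∀ x → δ x x ≡ 1ℤ
δ-refl zero    = refl
δ-refl (suc x) = δ-refl x

δ-≢ : ∀ {x y} → x ≢ y → δ x y ≡ 0ℤ
δ-≢ {zero}  {zero}  x≢y = ⊥-elim (x≢y refl)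
δ-≢ {zero}  {suc y} x≢y = refl
δ-≢ {suc x} {zero}  x≢y = refl
δ-≢ {suc x} {suc y} x≢y = δ-≢ (x≢y ∘ cong suc)

δ-transport : ∀ x y (f : ℕ → ℤ) → δ x y * f x ≡ δ x y * f y
δ-transport x y f with x ℕ.≟ y
... | yes refl = refl
... | no  x≢y  = trans (cong (_* f x) (δ-≢ x≢y)) (sym (cong (_* f y) (δ-≢ x≢y)))

𝟙-≟ : ∀ x y → 𝟙 (x ℕ.≟ y) ≡ δ x y
𝟙-≟ x y with x ℕ.≟ y
... | yes refl = sym (δ-refl x)
... | no  x≢y  = sym (δ-≢ x≢y)

δ-+ : ∀ x y m → ∑[ a ∈ List.upTo (suc m) ] (δ x a * δ y (m ∸ a)) ≡ δ (x ℕ.+ y) m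
δ-+ zero    y zero    = trans (+-identityʳ _) (*-identityˡ (δ y 0))
δ-+ (suc x) y zero    = refl
δ-+ zero    y (suc m) = begin
  ∑[ a ∈ List.upTo (suc (suc m)) ] (δ 0 a * δ y (suc m ∸ a))
    ≡⟨ ∑-upTo-suc (suc m) (λ a → δ 0 a * δ y (suc m ∸ a)) ⟩
  1ℤ * δ y (suc m) + ∑[ t ∈ List.upTo (suc m) ] (0ℤ * δ y (m ∸ t))
    ≡⟨ cong₂ _+_ (*-identityˡ (δ y (suc m))) (∑-zero (List.upTo (suc m)) λ _ → refl) ⟩
  δ y (suc m) + 0ℤ
    ≡⟨ +-identityʳ (δ y (suc m)) ⟩
  δ y (suc m) ∎
  where open ≡-Reasoning
δ-+ (suc x) y (suc m) =
  trans (∑-upTo-suc (suc m) (λ a → δ (suc x) a * δ y (suc m ∸ a))) (trans (+-identityˡ _) (δ-+ x y m))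

δᵛ : Vec ℕ k → Vec ℕ k → ℤ
δᵛ []       []       = 1ℤ
δᵛ (x ∷ xs) (y ∷ ys) = δ x y * δᵛ xs ys

δᵛ-refl : ∀ (xs : Vec ℕ k) → δᵛ xs xs ≡ 1ℤ
δᵛ-refl []       = refl
δᵛ-refl (x ∷ xs) rewrite δ-refl x | δᵛ-refl xs = refl

δᵛ-≢ : ∀ {xs ys : Vec ℕ k} → xs ≢ ys → δᵛ xs ys ≡ 0ℤ
δᵛ-≢ {xs = []}     {[]}     xs≢ys = ⊥-elim (xs≢ys refl)
δᵛ-≢ {xs = x ∷ xs} {y ∷ ys} xs≢ys with x ℕ.≟ y
... | yes refl = trans (cong (δ x x *_) (δᵛ-≢ (xs≢ys ∘ cong (x ∷_)))) (*-zeroʳ (δ x x))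
... | no  x≢y  = cong (_* δᵛ xs ys) (δ-≢ x≢y)

δᵛ-++ : ∀ {m} (xs as : Vec ℕ m) (ys bs : Vec ℕ n) →
        δᵛ (xs Vec.++ ys) (as Vec.++ bs) ≡ δᵛ xs as * δᵛ ys bs
δᵛ-++ []       []       ys bs = sym (*-identityˡ _)
δᵛ-++ (x ∷ xs) (a ∷ as) ys bs =
  trans (cong (δ x a *_) (δᵛ-++ xs as ys bs)) (sym (*-assoc (δ x a) _ _))

divisors : Vec ℕ n → List (Vec ℕ n)
divisors []      = [] ∷ []
divisors (x ∷ e) = concatMap (λ a → map (a ∷_) (divisors e)) (List.upTo (suc x))

δᵛ-+ : ∀ (x y e : Vec ℕ n) →
       ∑[ a ∈ divisors e ] (δᵛ x a * δᵛ y (zipWith _∸_ e a)) ≡ δᵛ (zipWith ℕ._+_ x y) e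
δᵛ-+ []       []       []       = refl
δᵛ-+ (x ∷ xs) (y ∷ ys) (m ∷ e) = begin
  ∑ (concatMap (λ a → map (a ∷_) (divisors e)) (List.upTo (suc m))) F
    ≡⟨ ∑-concatMap (λ a → map (a ∷_) (divisors e)) (List.upTo (suc m)) F ⟩
  ∑[ a ∈ List.upTo (suc m) ] ∑ (map (a ∷_) (divisors e)) F
    ≡⟨ ∑-cong (List.upTo (suc m)) (λ a → trans (∑-map (a ∷_) (divisors e) F) (split a)) ⟩
  ∑[ a ∈ List.upTo (suc m) ] (δ x a * δ y (m ∸ a) * Rest)
    ≡⟨ trans (∑-cong (List.upTo (suc m)) λ a → *-comm (δ x a * δ y (m ∸ a)) Rest)
             (∑-*ˡ (List.upTo (suc m)) Rest (λ a → δ x a * δ y (m ∸ a))) ⟩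
  Rest * ∑[ a ∈ List.upTo (suc m) ] (δ x a * δ y (m ∸ a))
    ≡⟨ cong₂ _*_ (δᵛ-+ xs ys e) (δ-+ x y m) ⟩
  δᵛ (zipWith ℕ._+_ xs ys) e * δ (x ℕ.+ y) m
    ≡⟨ *-comm _ (δ (x ℕ.+ y) m) ⟩
  δᵛ (zipWith ℕ._+_ (x ∷ xs) (y ∷ ys)) (m ∷ e) ∎
  where
  open ≡-Reasoning
  F : Vec ℕ _ → ℤ
  F a = δᵛ (x ∷ xs) a * δᵛ (y ∷ ys) (zipWith _∸_ (m ∷ e) a)
  Rest : ℤ
  Rest = ∑[ a ∈ divisors e ] (δᵛ xs a * δᵛ ys (zipWith _∸_ e a))
  interchange : ∀ a b c d → a * b * (c * d) ≡ a * c * (b * d)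
  interchange = solve-∀
  split : ∀ a → ∑[ as ∈ divisors e ] F (a ∷ as) ≡ δ x a * δ y (m ∸ a) * Rest
  split a = trans (∑-cong (divisors e) λ as → interchange (δ x a) (δᵛ xs as) (δ y (m ∸ a)) _)
                  (∑-*ˡ (divisors e) (δ x a * δ y (m ∸ a)) _)

when≤ : ℕ → ℕ → ℤ → ℤ
when≤ b       zero    z = z
when≤ zero    (suc x) z = 0ℤ
when≤ (suc b) (suc x) z = when≤ b x z

when≤-*ˡ : ∀ b x z w → when≤ b x z * w ≡ when≤ b x (z * w)
when≤-*ˡ b       zero    z w = refl
when≤-*ˡ zero    (suc x) z w = refl
when≤-*ˡ (suc b) (suc x) z w = when≤-*ˡ b x z w

when≤-∑ : ∀ b x (xs : List A) f → when≤ b x (∑ xs f) ≡ ∑[ y ∈ xs ] when≤ b x (f y)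
when≤-∑ b       zero    xs f = refl
when≤-∑ zero    (suc x) xs f = sym (∑-zero xs λ _ → refl)
when≤-∑ (suc b) (suc x) xs f = when≤-∑ b x xs f

allAtMost : ℕ → Vec ℕ n → ℤ
allAtMost b []      = 1ℤ
allAtMost b (x ∷ v) = when≤ b x (allAtMost b v)

∑-upTo-δ : ∀ b y (g : ℕ → ℤ) → ∑[ x ∈ List.upTo (suc b) ] (δ x y * g x) ≡ when≤ b y (g y)
∑-upTo-δ zero    zero    g = trans (+-identityʳ _) (*-identityˡ (g 0))
∑-upTo-δ zero    (suc y) g = refl
∑-upTo-δ (suc b) y       g = trans (∑-upTo-suc (suc b) (λ x → δ x y * g x)) (step y)
  where
  step : ∀ y → δ 0 y * g 0 + ∑[ t ∈ List.upTo (suc b) ] (δ (suc t) y * g (suc t)) ≡ when≤ (suc b) y (g y)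
  step zero    = trans (cong (_+_ (1ℤ * g 0)) (∑-zero (List.upTo (suc b)) λ _ → refl))
                       (trans (+-identityʳ _) (*-identityˡ (g 0)))
  step (suc y) = trans (+-identityˡ _) (∑-upTo-δ b y (g ∘ suc))

∑-upTo-when≤ : ∀ b (h : ℕ → ℤ) → ∑ (List.upTo (suc b)) h ≡ ∑[ x ∈ List.upTo (suc b) ] when≤ b x (h x)
∑-upTo-when≤ zero    h = refl
∑-upTo-when≤ (suc b) h = begin
  ∑ (List.upTo (suc (suc b))) h                                ≡⟨ ∑-upTo-suc (suc b) h ⟩
  h 0 + ∑[ t ∈ List.upTo (suc b) ] h (suc t)                  ≡⟨ cong (_+_ (h 0)) (∑-upTo-when≤ b (h ∘ suc)) ⟩
  h 0 + ∑[ t ∈ List.upTo (suc b) ] when≤ b t (h (suc t))      ≡⟨ sym (∑-upTo-suc (suc b) (λ x → when≤ (suc b) x (h x))) ⟩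
  ∑[ x ∈ List.upTo (suc (suc b)) ] when≤ (suc b) x (h x)      ∎
  where open ≡-Reasoning

∑-allVecs-allAtMost : ∀ b n (g : Vec ℕ n → ℤ) →
                      ∑ (allVecs (List.upTo (suc b)) n) g
                      ≡ ∑[ c ∈ allVecs (List.upTo (suc b)) n ] (allAtMost b c * g c)
∑-allVecs-allAtMost b zero    g = cong (_+ 0ℤ) (sym (*-identityˡ (g [])))
∑-allVecs-allAtMost b (suc n) g = begin
  ∑ (allVecs xs (suc n)) g
    ≡⟨ ∑-allVecs-suc xs n g ⟩
  ∑[ x ∈ xs ] ∑[ v ∈ allVecs xs n ] g (x ∷ v)
    ≡⟨ ∑-upTo-when≤ b (λ x → ∑[ v ∈ allVecs xs n ] g (x ∷ v)) ⟩
  ∑[ x ∈ xs ] when≤ b x (∑[ v ∈ allVecs xs n ] g (x ∷ v))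
    ≡⟨ ∑-cong xs (λ x → cong (when≤ b x) (∑-allVecs-allAtMost b n (g ∘ (x ∷_)))) ⟩
  ∑[ x ∈ xs ] when≤ b x (∑[ v ∈ allVecs xs n ] (allAtMost b v * g (x ∷ v)))
    ≡⟨ ∑-cong xs (λ x → trans (when≤-∑ b x (allVecs xs n) _)
                                (∑-cong (allVecs xs n) λ v → sym (when≤-*ˡ b x (allAtMost b v) _))) ⟩
  ∑[ x ∈ xs ] ∑[ v ∈ allVecs xs n ] (allAtMost b (x ∷ v) * g (x ∷ v))
    ≡⟨ sym (∑-allVecs-suc xs n _) ⟩
  ∑[ c ∈ allVecs xs (suc n) ] (allAtMost b c * g c) ∎
  where
  open ≡-Reasoning
  xs = List.upTo (suc b)

∑-allVecs-δᵛ : ∀ b n (e : Vec ℕ n) (f : Vec ℕ n → ℤ) →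
               ∑[ x ∈ allVecs (List.upTo (suc b)) n ] (δᵛ x e * f x) ≡ allAtMost b e * f e
∑-allVecs-δᵛ b zero    []      f = +-identityʳ _
∑-allVecs-δᵛ b (suc n) (y ∷ e) f = begin
  ∑[ x ∈ allVecs xs (suc n) ] (δᵛ x (y ∷ e) * f x)
    ≡⟨ ∑-allVecs-suc xs n _ ⟩
  ∑[ x ∈ xs ] ∑[ v ∈ allVecs xs n ] (δ x y * δᵛ v e * f (x ∷ v))
    ≡⟨ ∑-cong xs (λ x → trans (∑-cong (allVecs xs n) λ v → *-assoc (δ x y) _ _)
                                (∑-*ˡ (allVecs xs n) (δ x y) _)) ⟩
  ∑[ x ∈ xs ] (δ x y * ∑[ v ∈ allVecs xs n ] (δᵛ v e * f (x ∷ v)))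
    ≡⟨ ∑-cong xs (λ x → cong (δ x y *_) (∑-allVecs-δᵛ b n e (f ∘ (x ∷_)))) ⟩
  ∑[ x ∈ xs ] (δ x y * (allAtMost b e * f (x ∷ e)))
    ≡⟨ ∑-upTo-δ b y (λ x → allAtMost b e * f (x ∷ e)) ⟩
  when≤ b y (allAtMost b e * f (y ∷ e))
    ≡⟨ sym (when≤-*ˡ b y _ _) ⟩
  allAtMost b (y ∷ e) * f (y ∷ e) ∎
  where
  open ≡-Reasoning
  xs = List.upTo (suc b)

termCoeff : Vec ℕ k → ℤ × Vec ℕ k → ℤ
termCoeff e (c , v) = δᵛ v e * c

coeff-∑ : ∀ (p : Poly k) e → coeff p e ≡ ∑ p (termCoeff e)
coeff-∑ []             e = refl
coeff-∑ ((c , v) ∷ p) e with Vecₚ.≡-dec ℕ._≟_ v e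
... | yes refl = cong₂ _+_ (sym (trans (cong (_* c) (δᵛ-refl v)) (*-identityˡ c))) (coeff-∑ p e)
... | no  v≢e  = trans (coeff-∑ p e) (sym (trans (cong (λ d → d * c + ∑ p (termCoeff e)) (δᵛ-≢ v≢e)) (+-identityˡ _)))

coeff-++ : ∀ (p q : Poly k) e → coeff (p ++ q) e ≡ coeff p e + coeff q e
coeff-++ p q e = begin
  coeff (p ++ q) e                              ≡⟨ coeff-∑ (p ++ q) e ⟩
  ∑ (p ++ q) (termCoeff e)                      ≡⟨ ∑-++ p q (termCoeff e) ⟩
  ∑ p (termCoeff e) + ∑ q (termCoeff e)         ≡⟨ sym (cong₂ _+_ (coeff-∑ p e) (coeff-∑ q e)) ⟩
  coeff p e + coeff q e                         ∎
  where open ≡-Reasoning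

coeff-concatMap : ∀ (g : A → Poly k) (xs : List A) e →
                  coeff (concatMap g xs) e ≡ ∑[ x ∈ xs ] coeff (g x) e
coeff-concatMap g xs e = begin
  coeff (concatMap g xs) e                      ≡⟨ coeff-∑ (concatMap g xs) e ⟩
  ∑ (concatMap g xs) (termCoeff e)              ≡⟨ ∑-concatMap g xs (termCoeff e) ⟩
  ∑[ x ∈ xs ] ∑ (g x) (termCoeff e)             ≡⟨ ∑-cong xs (λ x → sym (coeff-∑ (g x) e)) ⟩
  ∑[ x ∈ xs ] coeff (g x) e                     ∎
  where open ≡-Reasoning

coeff-map : ∀ (g : ℤ × Vec ℕ k → ℤ × Vec ℕ k) (p : Poly k) e e′ κ →
            (∀ t → termCoeff e (g t) ≡ κ * termCoeff e′ t) →
            coeff (map g p) e ≡ κ * coeff p e′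
coeff-map g p e e′ κ g-scales = begin
  coeff (map g p) e                             ≡⟨ coeff-∑ (map g p) e ⟩
  ∑ (map g p) (termCoeff e)                     ≡⟨ ∑-map g p (termCoeff e) ⟩
  ∑[ t ∈ p ] termCoeff e (g t)                  ≡⟨ ∑-cong p g-scales ⟩
  ∑[ t ∈ p ] (κ * termCoeff e′ t)               ≡⟨ ∑-*ˡ p κ (termCoeff e′) ⟩
  κ * ∑ p (termCoeff e′)                        ≡⟨ cong (κ *_) (sym (coeff-∑ p e′)) ⟩
  κ * coeff p e′                                ∎
  where open ≡-Reasoning

coeff-scale : ∀ a (p : Poly k) e → coeff (scale a p) e ≡ a * coeff p e
coeff-scale a p e = coeff-map _ p e e a (λ (c , v) → swap (δᵛ v e) a c)
  where
  swap : ∀ x a c → x * (a * c) ≡ a * (x * c)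
  swap = solve-∀

coeff-neg : ∀ (p : Poly k) e → coeff (neg p) e ≡ - coeff p e
coeff-neg p e = trans (coeff-scale (- 1ℤ) p e) (-1*i≡-i (coeff p e))

δᵛ-updateAt : ∀ (f h : ℕ → ℕ) (g κ : ℕ → ℤ) →
              (∀ x y → δ (f x) y * g x ≡ κ y * δ x (h y)) →
              ∀ i (v e : Vec ℕ k) →
              δᵛ (v [ i ]%= f) e * g (lookup v i) ≡ κ (lookup e i) * δᵛ v (e [ i ]%= h)
δᵛ-updateAt f h g κ step Fin.zero (x ∷ v) (y ∷ e) = begin
  δ (f x) y * δᵛ v e * g x                      ≡⟨ exchange (δ (f x) y) (δᵛ v e) (g x) ⟩
  δ (f x) y * g x * δᵛ v e                      ≡⟨ cong (_* δᵛ v e) (step x y) ⟩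
  κ y * δ x (h y) * δᵛ v e                      ≡⟨ *-assoc (κ y) _ _ ⟩
  κ y * (δ x (h y) * δᵛ v e)                    ∎
  where
  open ≡-Reasoning
  exchange : ∀ a b c → a * b * c ≡ a * c * b
  exchange = solve-∀
δᵛ-updateAt f h g κ step (Fin.suc i) (x ∷ v) (y ∷ e) = begin
  δ x y * δᵛ (v [ i ]%= f) e * g (lookup v i)   ≡⟨ *-assoc (δ x y) _ _ ⟩
  δ x y * (δᵛ (v [ i ]%= f) e * g (lookup v i)) ≡⟨ cong (δ x y *_) (δᵛ-updateAt f h g κ step i v e) ⟩
  δ x y * (κ (lookup e i) * δᵛ v (e [ i ]%= h)) ≡⟨ *-left-comm (δ x y) (κ (lookup e i)) _ ⟩
  κ (lookup e i) * (δ x y * δᵛ v (e [ i ]%= h)) ∎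
  where
  open ≡-Reasoning
  *-left-comm : ∀ a b c → a * (b * c) ≡ b * (a * c)
  *-left-comm = solve-∀

nonzero : ℕ → ℤ
nonzero zero    = 0ℤ
nonzero (suc _) = 1ℤ

coeff-mulVar : ∀ (i : Fin k) p e →
               coeff (mulVar i p) e ≡ nonzero (lookup e i) * coeff p (e [ i ]%= ℕ.pred)
coeff-mulVar i p e = coeff-map _ p e (e [ i ]%= ℕ.pred) (nonzero (lookup e i)) λ (c , v) → begin
  δᵛ (v [ i ]%= suc) e * c                                ≡⟨ cong (_* c) (sym (*-identityʳ (δᵛ (v [ i ]%= suc) e))) ⟩
  δᵛ (v [ i ]%= suc) e * 1ℤ * c                           ≡⟨ cong (_* c) (δᵛ-updateAt suc ℕ.pred (λ _ → 1ℤ) nonzero step i v e) ⟩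
  nonzero (lookup e i) * δᵛ v (e [ i ]%= ℕ.pred) * c      ≡⟨ *-assoc (nonzero (lookup e i)) _ c ⟩
  nonzero (lookup e i) * (δᵛ v (e [ i ]%= ℕ.pred) * c)    ∎
  where
  open ≡-Reasoning
  step : ∀ x y → δ (suc x) y * 1ℤ ≡ nonzero y * δ x (ℕ.pred y)
  step x zero    = refl
  step x (suc y) = trans (*-identityʳ (δ x y)) (sym (*-identityˡ (δ x y)))

coeff-x²∂ : ∀ (i : Fin k) p e →
            coeff (mulVar i (mulVar i (deriv i p))) e ≡ + (lookup e i ∸ 1) * coeff p (e [ i ]%= ℕ.pred)
coeff-x²∂ i p e = begin
  coeff (mulVar i (mulVar i (deriv i p))) e
    ≡⟨ cong (λ q → coeff q e) (trans (cong (mulVar i) (sym (Listₚ.map-∘ p))) (sym (Listₚ.map-∘ p))) ⟩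
  coeff (map _ p) e
    ≡⟨ coeff-map _ p e (e [ i ]%= ℕ.pred) (+ (lookup e i ∸ 1)) per-term ⟩
  + (lookup e i ∸ 1) * coeff p (e [ i ]%= ℕ.pred) ∎
  where
  open ≡-Reasoning
  lift : ℕ → ℕ
  lift x = suc (suc (ℕ.pred x))
  step : ∀ x y → δ (lift x) y * + x ≡ + (y ∸ 1) * δ x (ℕ.pred y)
  step zero    zero          = refl
  step zero    (suc zero)    = refl
  step zero    (suc (suc y)) = trans (*-zeroʳ (δ 0 y)) (sym (*-zeroʳ (+ suc y)))
  step (suc x) zero          = refl
  step (suc x) (suc zero)    = refl
  step (suc x) (suc (suc y)) = trans (δ-transport x y (λ z → + suc z)) (*-comm (δ x y) (+ suc y))
  per-term : ∀ t → termCoeff e (_ , ((proj₂ t [ i ]%= ℕ.pred) [ i ]%= suc) [ i ]%= suc)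
                   ≡ + (lookup e i ∸ 1) * termCoeff (e [ i ]%= ℕ.pred) t
  per-term (c , v) = begin
    δᵛ (((v [ i ]%= ℕ.pred) [ i ]%= suc) [ i ]%= suc) e * (c * + lookup v i)
      ≡⟨ cong (λ w → δᵛ w e * (c * + lookup v i))
              (trans (Vecₚ.updateAt-updateAt i (v [ i ]%= ℕ.pred))
                     (Vecₚ.updateAt-updateAt i v)) ⟩
    δᵛ (v [ i ]%= lift) e * (c * + lookup v i)
      ≡⟨ rearrange (δᵛ (v [ i ]%= lift) e) c (+ lookup v i) ⟩
    δᵛ (v [ i ]%= lift) e * + lookup v i * c
      ≡⟨ cong (_* c) (δᵛ-updateAt lift ℕ.pred +_ (λ y → + (y ∸ 1)) step i v e) ⟩
    + (lookup e i ∸ 1) * δᵛ v (e [ i ]%= ℕ.pred) * c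
      ≡⟨ *-assoc (+ (lookup e i ∸ 1)) _ c ⟩
    + (lookup e i ∸ 1) * (δᵛ v (e [ i ]%= ℕ.pred) * c) ∎
    where
    rearrange : ∀ d c x → d * (c * x) ≡ d * x * c
    rearrange = solve-∀

-- (x − x² ∂/∂x) x^{a−1} = (1 − (a − 1)) x^a
raiseWeight : ℕ → ℤ
raiseWeight zero    = 0ℤ
raiseWeight (suc a) = 1ℤ ℤ.- + a

coeff-raiseOp : ∀ (i : Fin k) p e →
                coeff (raiseOp i p) e ≡ raiseWeight (lookup e i) * coeff p (e [ i ]%= ℕ.pred)
coeff-raiseOp i p e = begin
  coeff (raiseOp i p) e
    ≡⟨ coeff-++ (mulVar i p) (neg (mulVar i (mulVar i (deriv i p)))) e ⟩
  coeff (mulVar i p) e + coeff (neg (mulVar i (mulVar i (deriv i p)))) e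
    ≡⟨ cong₂ _+_ (coeff-mulVar i p e)
                 (trans (coeff-neg (mulVar i (mulVar i (deriv i p))) e) (cong -_ (coeff-x²∂ i p e))) ⟩
  nonzero (lookup e i) * coeff p (e [ i ]%= ℕ.pred) + - (+ (lookup e i ∸ 1) * coeff p (e [ i ]%= ℕ.pred))
    ≡⟨ combine (lookup e i) (coeff p (e [ i ]%= ℕ.pred)) ⟩
  raiseWeight (lookup e i) * coeff p (e [ i ]%= ℕ.pred) ∎
  where
  open ≡-Reasoning
  combine : ∀ x c → nonzero x * c + - (+ (x ∸ 1) * c) ≡ raiseWeight x * c
  combine zero    c = refl
  combine (suc a) c = ring c (+ a)
    where
    ring : ∀ c a → 1ℤ * c + - (a * c) ≡ (1ℤ ℤ.- a) * c
    ring = solve-∀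

coeff-diag : ∀ n (p : Poly (n ℕ.+ n)) e →
             coeff (diag n p) e ≡ ∑[ a ∈ divisors e ] coeff p (a Vec.++ zipWith _∸_ e a)
coeff-diag n p e = begin
  coeff (diag n p) e
    ≡⟨ trans (coeff-∑ (diag n p) e) (∑-map _ p (termCoeff e)) ⟩
  ∑[ (c , v) ∈ p ] (δᵛ (zipWith ℕ._+_ (take n v) (drop n v)) e * c)
    ≡⟨ ∑-cong p (λ (c , v) → cong (_* c) (sym (trans (∑-cong (divisors e) (halves v))
                                                       (δᵛ-+ (take n v) (drop n v) e)))) ⟩
  ∑[ (c , v) ∈ p ] (∑[ a ∈ divisors e ] δᵛ v (a Vec.++ zipWith _∸_ e a) * c)
    ≡⟨ ∑-cong p (λ (c , v) → trans (*-comm _ c) (sym (∑-*ˡ (divisors e) c _))) ⟩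
  ∑[ (c , v) ∈ p ] ∑[ a ∈ divisors e ] (c * δᵛ v (a Vec.++ zipWith _∸_ e a))
    ≡⟨ ∑-swap p (divisors e) _ ⟩
  ∑[ a ∈ divisors e ] ∑[ (c , v) ∈ p ] (c * δᵛ v (a Vec.++ zipWith _∸_ e a))
    ≡⟨ ∑-cong (divisors e) (λ a → trans (∑-cong p λ (c , v) → *-comm c _) (sym (coeff-∑ p _))) ⟩
  ∑[ a ∈ divisors e ] coeff p (a Vec.++ zipWith _∸_ e a) ∎
  where
  open ≡-Reasoning
  halves : ∀ (v : Vec ℕ (n ℕ.+ n)) (a : Vec ℕ n) →
           δᵛ v (a Vec.++ zipWith _∸_ e a) ≡ δᵛ (take n v) a * δᵛ (drop n v) (zipWith _∸_ e a)
  halves v a = trans (cong (λ w → δᵛ w (a Vec.++ zipWith _∸_ e a)) (sym (Vecₚ.take++drop≡id n v)))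
                     (δᵛ-++ (take n v) a (drop n v) (zipWith _∸_ e a))

-- The action of Σ_i (x_i − x_i² ∂/∂x_i) on coefficient functions; see coeff-Xplus.
raiseᵀ : (Vec ℕ n → ℤ) → Vec ℕ n → ℤ
raiseᵀ F []      = 0ℤ
raiseᵀ F (x ∷ a) = raiseWeight x * F (ℕ.pred x ∷ a) + raiseᵀ (λ v → F (x ∷ v)) a

raiseᵀ-cong : ∀ {F G : Vec ℕ n → ℤ} a → (∀ v → F v ≡ G v) → raiseᵀ F a ≡ raiseᵀ G a
raiseᵀ-cong []      F≗G = refl
raiseᵀ-cong (x ∷ a) F≗G = cong₂ _+_ (cong (raiseWeight x *_) (F≗G _)) (raiseᵀ-cong a (F≗G ∘ (x ∷_)))

raiseᵀ-zero : ∀ (a : Vec ℕ n) → raiseᵀ (λ _ → 0ℤ) a ≡ 0ℤ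
raiseᵀ-zero []      = refl
raiseᵀ-zero (x ∷ a) = cong₂ _+_ (*-zeroʳ (raiseWeight x)) (raiseᵀ-zero a)

raiseᵀ-*ˡ : ∀ κ (F : Vec ℕ n → ℤ) a → raiseᵀ (λ v → κ * F v) a ≡ κ * raiseᵀ F a
raiseᵀ-*ˡ κ F []      = sym (*-zeroʳ κ)
raiseᵀ-*ˡ κ F (x ∷ a) =
  trans (cong (_+_ (raiseWeight x * (κ * F (ℕ.pred x ∷ a)))) (raiseᵀ-*ˡ κ (F ∘ (x ∷_)) a))
        (distrib (raiseWeight x) κ _ _)
  where
  distrib : ∀ w κ f r → w * (κ * f) + κ * r ≡ κ * (w * f + r)
  distrib = solve-∀

raiseᵀ-∑ : ∀ (xs : List A) (κ : A → ℤ) (F : A → Vec ℕ n → ℤ) a →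
           raiseᵀ (λ v → ∑[ x ∈ xs ] (κ x * F x v)) a ≡ ∑[ x ∈ xs ] (κ x * raiseᵀ (F x) a)
raiseᵀ-∑ xs κ F []      = sym (∑-zero xs λ x → *-zeroʳ (κ x))
raiseᵀ-∑ xs κ F (y ∷ a) = begin
  raiseWeight y * ∑[ x ∈ xs ] (κ x * F x (ℕ.pred y ∷ a)) + raiseᵀ (λ v → ∑[ x ∈ xs ] (κ x * F x (y ∷ v))) a
    ≡⟨ cong₂ _+_ (sym (∑-*ˡ xs (raiseWeight y) _)) (raiseᵀ-∑ xs κ (λ x → F x ∘ (y ∷_)) a) ⟩
  ∑[ x ∈ xs ] (raiseWeight y * (κ x * F x (ℕ.pred y ∷ a))) + ∑[ x ∈ xs ] (κ x * raiseᵀ (F x ∘ (y ∷_)) a)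
    ≡⟨ sym (∑-+ xs _ _) ⟩
  ∑[ x ∈ xs ] (raiseWeight y * (κ x * F x (ℕ.pred y ∷ a)) + κ x * raiseᵀ (F x ∘ (y ∷_)) a)
    ≡⟨ ∑-cong xs (λ x → distrib (raiseWeight y) (κ x) _ _) ⟩
  ∑[ x ∈ xs ] (κ x * raiseᵀ (F x) (y ∷ a)) ∎
  where
  open ≡-Reasoning
  distrib : ∀ w κ f r → w * (κ * f) + κ * r ≡ κ * (w * f + r)
  distrib = solve-∀

iter-raiseᵀ-cong : ∀ t {F G : Vec ℕ n → ℤ} → (∀ v → F v ≡ G v) → ∀ a → iter t raiseᵀ F a ≡ iter t raiseᵀ G a
iter-raiseᵀ-cong zero    F≗G a = F≗G a
iter-raiseᵀ-cong (suc t) F≗G a = raiseᵀ-cong a (iter-raiseᵀ-cong t F≗G)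

iter-raiseᵀ-*ˡ : ∀ t κ (F : Vec ℕ n → ℤ) a → iter t raiseᵀ (λ v → κ * F v) a ≡ κ * iter t raiseᵀ F a
iter-raiseᵀ-*ˡ zero    κ F a = refl
iter-raiseᵀ-*ˡ (suc t) κ F a =
  trans (raiseᵀ-cong a (iter-raiseᵀ-*ˡ t κ F)) (raiseᵀ-*ˡ κ (iter t raiseᵀ F) a)

iter-raiseᵀ-∑ : ∀ t (xs : List A) (κ : A → ℤ) (F : A → Vec ℕ n → ℤ) a →
                iter t raiseᵀ (λ v → ∑[ x ∈ xs ] (κ x * F x v)) a ≡ ∑[ x ∈ xs ] (κ x * iter t raiseᵀ (F x) a)
iter-raiseᵀ-∑ zero    xs κ F a = refl
iter-raiseᵀ-∑ (suc t) xs κ F a =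
  trans (raiseᵀ-cong a (iter-raiseᵀ-∑ t xs κ F)) (raiseᵀ-∑ xs κ (λ x → iter t raiseᵀ (F x)) a)

∑-raiseWeight≡raiseᵀ : ∀ (F : Vec ℕ n → ℤ) a →
           ∑[ i ∈ List.allFin n ] (raiseWeight (lookup a i) * F (a [ i ]%= ℕ.pred)) ≡ raiseᵀ F a
∑-raiseWeight≡raiseᵀ F []      = refl
∑-raiseWeight≡raiseᵀ F (x ∷ a) = cong (_+_ (raiseWeight x * F (ℕ.pred x ∷ a))) (begin
  ∑ (List.tabulate Fin.suc) G            ≡⟨ cong (λ is → ∑ is G) (sym (Listₚ.map-tabulate id Fin.suc)) ⟩
  ∑ (map Fin.suc (List.allFin _)) G     ≡⟨ ∑-map Fin.suc (List.allFin _) G ⟩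
  ∑[ i ∈ List.allFin _ ] G (Fin.suc i)  ≡⟨ ∑-raiseWeight≡raiseᵀ (F ∘ (x ∷_)) a ⟩
  raiseᵀ (F ∘ (x ∷_)) a                 ∎)
  where
  open ≡-Reasoning
  G : Fin (suc _) → ℤ
  G i = raiseWeight (lookup (x ∷ a) i) * F ((x ∷ a) [ i ]%= ℕ.pred)

updateAt-++ˡ : ∀ {m} (a : Vec ℕ m) (b : Vec ℕ n) i f → (a Vec.++ b) [ i Fin.↑ˡ n ]%= f ≡ (a [ i ]%= f) Vec.++ b
updateAt-++ˡ (x ∷ a) b Fin.zero    f = refl
updateAt-++ˡ (x ∷ a) b (Fin.suc i) f = cong (x ∷_) (updateAt-++ˡ a b i f)

updateAt-++ʳ : ∀ {m} (a : Vec ℕ m) (b : Vec ℕ n) i f → (a Vec.++ b) [ m Fin.↑ʳ i ]%= f ≡ a Vec.++ (b [ i ]%= f)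
updateAt-++ʳ []      b i f = refl
updateAt-++ʳ (x ∷ a) b i f = cong (x ∷_) (updateAt-++ʳ a b i f)

coeff-Xplus : ∀ n (p : Poly (n ℕ.+ n)) (a b : Vec ℕ n) →
              coeff (Xplus n p) (a Vec.++ b) ≡ raiseᵀ (λ a′ → coeff p (a′ Vec.++ b)) a
coeff-Xplus n p a b = trans (coeff-concatMap _ (List.allFin n) (a Vec.++ b)) (trans
  (∑-cong (List.allFin n) λ i → trans (coeff-raiseOp (i Fin.↑ˡ n) p (a Vec.++ b))
     (cong₂ (λ x v → raiseWeight x * coeff p v) (Vecₚ.lookup-++ˡ a b i) (updateAt-++ˡ a b i ℕ.pred)))
  (∑-raiseWeight≡raiseᵀ (λ a′ → coeff p (a′ Vec.++ b)) a))

coeff-Yplus : ∀ n (p : Poly (n ℕ.+ n)) (a b : Vec ℕ n) →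
              coeff (Yplus n p) (a Vec.++ b) ≡ raiseᵀ (λ b′ → coeff p (a Vec.++ b′)) b
coeff-Yplus n p a b = trans (coeff-concatMap _ (List.allFin n) (a Vec.++ b)) (trans
  (∑-cong (List.allFin n) λ i → trans (coeff-raiseOp (n Fin.↑ʳ i) p (a Vec.++ b))
     (cong₂ (λ x v → raiseWeight x * coeff p v) (Vecₚ.lookup-++ʳ a b i) (updateAt-++ʳ a b i ℕ.pred)))
  (∑-raiseWeight≡raiseᵀ (λ b′ → coeff p (a Vec.++ b′)) b))

coeff-iter-Xplus : ∀ n T (p : Poly (n ℕ.+ n)) (a b : Vec ℕ n) →
                   coeff (iter T (Xplus n) p) (a Vec.++ b) ≡ iter T raiseᵀ (λ a′ → coeff p (a′ Vec.++ b)) a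
coeff-iter-Xplus n zero    p a b = refl
coeff-iter-Xplus n (suc T) p a b =
  trans (coeff-Xplus n (iter T (Xplus n) p) a b) (raiseᵀ-cong a λ a′ → coeff-iter-Xplus n T p a′ b)

coeff-iter-Yplus : ∀ n S (p : Poly (n ℕ.+ n)) (a b : Vec ℕ n) →
                   coeff (iter S (Yplus n) p) (a Vec.++ b) ≡ iter S raiseᵀ (λ b′ → coeff p (a Vec.++ b′)) b
coeff-iter-Yplus n zero    p a b = refl
coeff-iter-Yplus n (suc S) p a b =
  trans (coeff-Yplus n (iter S (Yplus n) p) a b) (raiseᵀ-cong b λ b′ → coeff-iter-Yplus n S p a b′)

-- Raising squarefree monomials

-- sqfreeOver c m a is 1 when x^a is a squarefree monomial of degree m divisible by x^c, and 0 otherwise.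
sqfreeOver : Vec ℕ n → ℕ → Vec ℕ n → ℤ
sqfreeOver []                 m       []                = δ m 0
sqfreeOver (c ∷ cs)           m       (suc (suc _) ∷ a) = 0ℤ
sqfreeOver (zero ∷ cs)        m       (zero ∷ a)        = sqfreeOver cs m a
sqfreeOver (suc _ ∷ cs)       m       (zero ∷ a)        = 0ℤ
sqfreeOver (c ∷ cs)           zero    (suc zero ∷ a)    = 0ℤ
sqfreeOver (zero ∷ cs)        (suc m) (suc zero ∷ a)    = sqfreeOver cs m a
sqfreeOver (suc zero ∷ cs)    (suc m) (suc zero ∷ a)    = sqfreeOver cs m a
sqfreeOver (suc (suc _) ∷ cs) (suc m) (suc zero ∷ a)    = 0ℤ

sqfreeOver-< : ∀ (c : Vec ℕ n) m a → m < count 1 c → sqfreeOver c m a ≡ 0ℤ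
sqfreeOver-< []                 m       []                ()
sqfreeOver-< (c ∷ cs)           m       (suc (suc _) ∷ a) m<∣c∣ = refl
sqfreeOver-< (zero ∷ cs)        m       (zero ∷ a)        m<∣c∣ = sqfreeOver-< cs m a m<∣c∣
sqfreeOver-< (suc _ ∷ cs)       m       (zero ∷ a)        m<∣c∣ = refl
sqfreeOver-< (c ∷ cs)           zero    (suc zero ∷ a)    m<∣c∣ = refl
sqfreeOver-< (zero ∷ cs)        (suc m) (suc zero ∷ a)    m<∣c∣ = sqfreeOver-< cs m a (ℕₚ.≤-trans (ℕₚ.n≤1+n _) m<∣c∣)
sqfreeOver-< (suc zero ∷ cs)    (suc m) (suc zero ∷ a)    (s≤s m<∣c∣) = sqfreeOver-< cs m a m<∣c∣
sqfreeOver-< (suc (suc _) ∷ cs) (suc m) (suc zero ∷ a)    m<∣c∣ = refl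

sqfreeOver-self : ∀ (c a : Vec ℕ n) →
                  allAtMost 1 c * sqfreeOver c (count 1 c) a ≡ allAtMost 1 c * δᵛ c a
sqfreeOver-self []                 []                = refl
sqfreeOver-self (suc (suc _) ∷ cs) (a₀ ∷ a)          = refl
sqfreeOver-self (zero ∷ cs)        (zero ∷ a)
  rewrite *-identityˡ (δᵛ cs a) = sqfreeOver-self cs a
sqfreeOver-self (zero ∷ cs)        (suc zero ∷ a)
  = cong (allAtMost 1 cs *_) (absent (count 1 cs) refl)
  where
  absent : ∀ k → count 1 cs ≡ k → sqfreeOver (zero ∷ cs) k (suc zero ∷ a) ≡ 0ℤ
  absent zero    _  = refl
  absent (suc k) eq = sqfreeOver-< cs k a (ℕₚ.≤-reflexive (sym eq))
sqfreeOver-self (zero ∷ cs)        (suc (suc _) ∷ a) = refl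
sqfreeOver-self (suc zero ∷ cs)    (zero ∷ a)        = refl
sqfreeOver-self (suc zero ∷ cs)    (suc zero ∷ a)
  rewrite *-identityˡ (δᵛ cs a) = sqfreeOver-self cs a
sqfreeOver-self (suc zero ∷ cs)    (suc (suc _) ∷ a) = refl

-- As raiseWeight 2 = 0, raising never leaves the squarefree monomials, and a squarefree x^a of degree
-- m + 1 divisible by x^c is reached from the m + 1 − |c| = d + 1 monomials x^a / x_i with x_i ∤ x^c.
raiseᵀ-sqfreeOver : ∀ (c : Vec ℕ n) d m → count 1 c ℕ.+ d ≡ m →
                    ∀ a → raiseᵀ (sqfreeOver c m) a ≡ + suc d * sqfreeOver c (suc m) a
raiseᵀ-sqfreeOver []                 d m       _     []                = sym (*-zeroʳ (+ suc d))
raiseᵀ-sqfreeOver (c ∷ cs)           d m       _     (suc (suc zero) ∷ a) =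
  trans (+-identityˡ _) (trans (raiseᵀ-zero a) (sym (*-zeroʳ (+ suc d))))
raiseᵀ-sqfreeOver (c ∷ cs)           d m       _     (suc (suc (suc x)) ∷ a) =
  trans (cong₂ _+_ (*-zeroʳ (raiseWeight (3 ℕ.+ x))) (raiseᵀ-zero a)) (sym (*-zeroʳ (+ suc d)))
raiseᵀ-sqfreeOver (zero ∷ cs)        d m       ∣c∣+d≡m (zero ∷ a) =
  trans (+-identityˡ _) (raiseᵀ-sqfreeOver cs d m ∣c∣+d≡m a)
raiseᵀ-sqfreeOver (suc _ ∷ cs)       d m       _     (zero ∷ a) =
  trans (+-identityˡ _) (trans (raiseᵀ-zero a) (sym (*-zeroʳ (+ suc d))))
raiseᵀ-sqfreeOver (zero ∷ cs)        d zero    ∣c∣+d≡0 (suc zero ∷ a)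
  rewrite ℕₚ.m+n≡0⇒n≡0 (count 1 cs) ∣c∣+d≡0 =
  trans (cong (_+_ (1ℤ * sqfreeOver cs 0 a)) (raiseᵀ-zero a)) (+-identityʳ _)
raiseᵀ-sqfreeOver (zero ∷ cs)        zero (suc m) ∣c∣≡1+m (suc zero ∷ a) = begin
  1ℤ * sqfreeOver cs (suc m) a + raiseᵀ (sqfreeOver cs m) a
    ≡⟨ cong (_+_ (1ℤ * sqfreeOver cs (suc m) a)) (trans (raiseᵀ-cong a below) (raiseᵀ-zero a)) ⟩
  1ℤ * sqfreeOver cs (suc m) a + 0ℤ
    ≡⟨ +-identityʳ _ ⟩
  1ℤ * sqfreeOver cs (suc m) a ∎
  where
  open ≡-Reasoning
  below : ∀ v → sqfreeOver cs m v ≡ 0ℤ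
  below v = sqfreeOver-< cs m v (ℕₚ.≤-reflexive (sym (trans (sym (ℕₚ.+-identityʳ _)) ∣c∣≡1+m)))
raiseᵀ-sqfreeOver (zero ∷ cs)        (suc d) (suc m) ∣c∣+1+d≡1+m (suc zero ∷ a) = begin
  1ℤ * sqfreeOver cs (suc m) a + raiseᵀ (sqfreeOver cs m) a
    ≡⟨ cong (_+_ (1ℤ * sqfreeOver cs (suc m) a)) (raiseᵀ-sqfreeOver cs d m ∣c∣+d≡m a) ⟩
  1ℤ * sqfreeOver cs (suc m) a + + suc d * sqfreeOver cs (suc m) a
    ≡⟨ sym (*-distribʳ-+ (sqfreeOver cs (suc m) a) 1ℤ (+ suc d)) ⟩
  + suc (suc d) * sqfreeOver cs (suc m) a ∎
  where
  open ≡-Reasoning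
  ∣c∣+d≡m : count 1 cs ℕ.+ d ≡ m
  ∣c∣+d≡m = ℕₚ.suc-injective (trans (sym (ℕₚ.+-suc (count 1 cs) d)) ∣c∣+1+d≡1+m)
raiseᵀ-sqfreeOver (suc zero ∷ cs)    d zero    ()    (suc zero ∷ a)
raiseᵀ-sqfreeOver (suc zero ∷ cs)    d (suc m) ∣c∣+d≡m (suc zero ∷ a) =
  trans (+-identityˡ _) (raiseᵀ-sqfreeOver cs d m (ℕₚ.suc-injective ∣c∣+d≡m) a)
raiseᵀ-sqfreeOver (suc (suc _) ∷ cs) d zero    _     (suc zero ∷ a) =
  trans (+-identityˡ _) (trans (raiseᵀ-zero a) (sym (*-zeroʳ (+ suc d))))
raiseᵀ-sqfreeOver (suc (suc _) ∷ cs) d (suc m) _     (suc zero ∷ a) =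
  trans (+-identityˡ _) (trans (raiseᵀ-zero a) (sym (*-zeroʳ (+ suc d))))

iter-raiseᵀ-sqfreeOver : ∀ (c : Vec ℕ n) d m → count 1 c ℕ.+ d ≡ m → ∀ t a →
  + (d !) * iter t raiseᵀ (sqfreeOver c m) a ≡ + ((d ℕ.+ t) !) * sqfreeOver c (m ℕ.+ t) a
iter-raiseᵀ-sqfreeOver c d m ∣c∣+d≡m zero    a
  rewrite ℕₚ.+-identityʳ d | ℕₚ.+-identityʳ m = refl
iter-raiseᵀ-sqfreeOver c d m ∣c∣+d≡m (suc t) a = begin
  + (d !) * raiseᵀ (iter t raiseᵀ (sqfreeOver c m)) a
    ≡⟨ sym (raiseᵀ-*ˡ (+ (d !)) _ a) ⟩
  raiseᵀ (λ v → + (d !) * iter t raiseᵀ (sqfreeOver c m) v) a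
    ≡⟨ raiseᵀ-cong a (iter-raiseᵀ-sqfreeOver c d m ∣c∣+d≡m t) ⟩
  raiseᵀ (λ v → + ((d ℕ.+ t) !) * sqfreeOver c (m ℕ.+ t) v) a
    ≡⟨ raiseᵀ-*ˡ (+ ((d ℕ.+ t) !)) _ a ⟩
  + ((d ℕ.+ t) !) * raiseᵀ (sqfreeOver c (m ℕ.+ t)) a
    ≡⟨ cong (+ ((d ℕ.+ t) !) *_) (raiseᵀ-sqfreeOver c (d ℕ.+ t) (m ℕ.+ t) ∣c∣+d+t≡m+t a) ⟩
  + ((d ℕ.+ t) !) * (+ suc (d ℕ.+ t) * sqfreeOver c (suc (m ℕ.+ t)) a)
    ≡⟨ trans (sym (*-assoc (+ ((d ℕ.+ t) !)) (+ suc (d ℕ.+ t)) (sqfreeOver c (suc (m ℕ.+ t)) a)))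
             (cong (_* sqfreeOver c (suc (m ℕ.+ t)) a)
                   (trans (*-comm (+ ((d ℕ.+ t) !)) (+ suc (d ℕ.+ t)))
                          (sym (pos-* (suc (d ℕ.+ t)) ((d ℕ.+ t) !))))) ⟩
  + (suc (d ℕ.+ t) !) * sqfreeOver c (suc (m ℕ.+ t)) a
    ≡⟨ sym (cong₂ (λ k l → + (k !) * sqfreeOver c l a) (ℕₚ.+-suc d t) (ℕₚ.+-suc m t)) ⟩
  + ((d ℕ.+ suc t) !) * sqfreeOver c (m ℕ.+ suc t) a ∎
  where
  open ≡-Reasoning
  ∣c∣+d+t≡m+t : count 1 c ℕ.+ (d ℕ.+ t) ≡ m ℕ.+ t
  ∣c∣+d+t≡m+t = trans (sym (ℕₚ.+-assoc (count 1 c) d t)) (cong (ℕ._+ t) ∣c∣+d≡m)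

squarefreeOfDegree : ℕ → Vec ℕ n → ℤ
squarefreeOfDegree j c = allAtMost 1 c * δ (count 1 c) j

squarefreeOfDegree-δᵛ : ∀ j (c a : Vec ℕ n) →
                        squarefreeOfDegree j c * δᵛ c a ≡ squarefreeOfDegree j c * sqfreeOver c j a
squarefreeOfDegree-δᵛ j c a = begin
  allAtMost 1 c * δ ∣c∣ j * δᵛ c a              ≡⟨ shuffle (allAtMost 1 c) (δ ∣c∣ j) (δᵛ c a) ⟩
  δ ∣c∣ j * (allAtMost 1 c * δᵛ c a)            ≡⟨ cong (δ ∣c∣ j *_) (sym (sqfreeOver-self c a)) ⟩
  δ ∣c∣ j * (allAtMost 1 c * sqfreeOver c ∣c∣ a) ≡⟨ δ-transport ∣c∣ j (λ k → allAtMost 1 c * sqfreeOver c k a) ⟩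
  δ ∣c∣ j * (allAtMost 1 c * sqfreeOver c j a)  ≡⟨ sym (shuffle (allAtMost 1 c) (δ ∣c∣ j) _) ⟩
  allAtMost 1 c * δ ∣c∣ j * sqfreeOver c j a    ∎
  where
  open ≡-Reasoning
  ∣c∣ = count 1 c
  shuffle : ∀ x y z → x * y * z ≡ y * (x * z)
  shuffle = solve-∀

iter-raiseᵀ-squarefreeOfDegree : ∀ j (c : Vec ℕ n) t a →
  squarefreeOfDegree j c * iter t raiseᵀ (sqfreeOver c j) a
  ≡ squarefreeOfDegree j c * (+ (t !) * sqfreeOver c (j ℕ.+ t) a)
iter-raiseᵀ-squarefreeOfDegree j c t a with count 1 c ℕ.≟ j
... | yes refl = cong (squarefreeOfDegree j c *_)
                   (trans (sym (*-identityˡ _)) (iter-raiseᵀ-sqfreeOver c 0 j (ℕₚ.+-identityʳ j) t a))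
... | no  ∣c∣≢j = trans (cong (_* iter t raiseᵀ (sqfreeOver c j) a) vanishes)
                        (sym (cong (_* (+ (t !) * sqfreeOver c (j ℕ.+ t) a)) vanishes))
  where
  vanishes : squarefreeOfDegree j c ≡ 0ℤ
  vanishes = trans (cong (allAtMost 1 c *_) (δ-≢ ∣c∣≢j)) (*-zeroʳ (allAtMost 1 c))

-- The value list 0 ∷ 1 ∷ [] in m1xy is List.upTo 2 definitionally, and likewise 0 ∷ 1 ∷ 2 ∷ [] is List.upTo 3.
coeff-m1xy : ∀ n j (a b : Vec ℕ n) →
             coeff (m1xy n j) (a Vec.++ b)
             ≡ ∑[ c ∈ allVecs (List.upTo 2) n ] (squarefreeOfDegree j c * (δᵛ c a * δᵛ c b))
coeff-m1xy n j a b = begin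
  coeff (m1xy n j) (a Vec.++ b)
    ≡⟨ trans (coeff-∑ (m1xy n j) _) (∑-map _ (filter P? (allVecs V n)) _) ⟩
  ∑[ c ∈ filter P? (allVecs V n) ] (δᵛ (c Vec.++ c) (a Vec.++ b) * 1ℤ)
    ≡⟨ ∑-filter P? (allVecs V n) _ ⟩
  ∑[ c ∈ allVecs V n ] (𝟙 (P? c) * (δᵛ (c Vec.++ c) (a Vec.++ b) * 1ℤ))
    ≡⟨ ∑-cong (allVecs V n) (λ c → cong₂ _*_ (𝟙-≟ (count 1 c) j)
                                             (trans (*-identityʳ _) (δᵛ-++ c a c b))) ⟩
  ∑[ c ∈ allVecs V n ] (δ (count 1 c) j * (δᵛ c a * δᵛ c b))
    ≡⟨ trans (∑-allVecs-allAtMost 1 n _) (∑-cong (allVecs V n) λ c → sym (*-assoc (allAtMost 1 c) _ _)) ⟩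
  ∑[ c ∈ allVecs V n ] (squarefreeOfDegree j c * (δᵛ c a * δᵛ c b)) ∎
  where
  open ≡-Reasoning
  V = List.upTo 2
  P? : (c : Vec ℕ n) → Dec (count 1 c ≡ j)
  P? c = count 1 c ℕ.≟ j

coeff-m1xy-sqfreeOver : ∀ n j (a b : Vec ℕ n) →
  coeff (m1xy n j) (a Vec.++ b)
  ≡ ∑[ c ∈ allVecs (List.upTo 2) n ] (sqfreeOver c j a * (squarefreeOfDegree j c * sqfreeOver c j b))
coeff-m1xy-sqfreeOver n j a b = trans (coeff-m1xy n j a b) (∑-cong (allVecs (List.upTo 2) n) λ c → begin
  κ c * (δᵛ c a * δᵛ c b)               ≡⟨ exchange (κ c) (δᵛ c a) (δᵛ c b) ⟩
  δᵛ c b * (κ c * δᵛ c a)               ≡⟨ cong (δᵛ c b *_) (squarefreeOfDegree-δᵛ j c a) ⟩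
  δᵛ c b * (κ c * sqfreeOver c j a)     ≡⟨ exchange′ (δᵛ c b) (κ c) (sqfreeOver c j a) ⟩
  sqfreeOver c j a * (κ c * δᵛ c b)     ≡⟨ cong (sqfreeOver c j a *_) (squarefreeOfDegree-δᵛ j c b) ⟩
  sqfreeOver c j a * (κ c * sqfreeOver c j b) ∎)
  where
  open ≡-Reasoning
  κ = squarefreeOfDegree j
  exchange : ∀ k x y → k * (x * y) ≡ y * (k * x)
  exchange = solve-∀
  exchange′ : ∀ y k h → y * (k * h) ≡ h * (k * y)
  exchange′ = solve-∀

coeff-XY-m1xy : ∀ n j S T (a b : Vec ℕ n) →
  coeff (iter T (Xplus n) (iter S (Yplus n) (m1xy n j))) (a Vec.++ b)
  ≡ ∑[ c ∈ allVecs (List.upTo 2) n ]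
      (+ (S !) * sqfreeOver c (j ℕ.+ S) b * (squarefreeOfDegree j c * (+ (T !) * sqfreeOver c (j ℕ.+ T) a)))
coeff-XY-m1xy n j S T a b = begin
  coeff (iter T (Xplus n) (iter S (Yplus n) (m1xy n j))) (a Vec.++ b)
    ≡⟨ coeff-iter-Xplus n T _ a b ⟩
  iter T raiseᵀ (λ a′ → coeff (iter S (Yplus n) (m1xy n j)) (a′ Vec.++ b)) a
    ≡⟨ iter-raiseᵀ-cong T (λ a′ → trans (coeff-iter-Yplus n S _ a′ b)
                                       (iter-raiseᵀ-cong S (coeff-m1xy-sqfreeOver n j a′) b)) a ⟩
  iter T raiseᵀ (λ a′ → iter S raiseᵀ (λ b′ → ∑[ c ∈ V ] (sqfreeOver c j a′ * (κ c * sqfreeOver c j b′))) b) a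
    ≡⟨ iter-raiseᵀ-cong T (λ a′ → trans (iter-raiseᵀ-∑ S V (λ c → sqfreeOver c j a′) (λ c b′ → κ c * sqfreeOver c j b′) b)
                                       (∑-cong V (raise-b a′))) a ⟩
  iter T raiseᵀ (λ a′ → ∑[ c ∈ V ] (+ (S !) * sqfreeOver c (j ℕ.+ S) b * (κ c * sqfreeOver c j a′))) a
    ≡⟨ iter-raiseᵀ-∑ T V (λ c → + (S !) * sqfreeOver c (j ℕ.+ S) b) (λ c a′ → κ c * sqfreeOver c j a′) a ⟩
  ∑[ c ∈ V ] (+ (S !) * sqfreeOver c (j ℕ.+ S) b * iter T raiseᵀ (λ a′ → κ c * sqfreeOver c j a′) a)
    ≡⟨ ∑-cong V (λ c → cong (+ (S !) * sqfreeOver c (j ℕ.+ S) b *_)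
                            (trans (iter-raiseᵀ-*ˡ T (κ c) _ a) (iter-raiseᵀ-squarefreeOfDegree j c T a))) ⟩
  ∑[ c ∈ V ] (+ (S !) * sqfreeOver c (j ℕ.+ S) b * (κ c * (+ (T !) * sqfreeOver c (j ℕ.+ T) a))) ∎
  where
  open ≡-Reasoning
  V = allVecs (List.upTo 2) n
  κ = squarefreeOfDegree j
  exchange : ∀ h k x → h * (k * x) ≡ x * (k * h)
  exchange = solve-∀
  raise-b : ∀ a′ c → sqfreeOver c j a′ * iter S raiseᵀ (λ b′ → κ c * sqfreeOver c j b′) b
                     ≡ + (S !) * sqfreeOver c (j ℕ.+ S) b * (κ c * sqfreeOver c j a′)
  raise-b a′ c = begin
    sqfreeOver c j a′ * iter S raiseᵀ (λ b′ → κ c * sqfreeOver c j b′) b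
      ≡⟨ cong (sqfreeOver c j a′ *_) (iter-raiseᵀ-*ˡ S (κ c) (sqfreeOver c j) b) ⟩
    sqfreeOver c j a′ * (κ c * iter S raiseᵀ (sqfreeOver c j) b)
      ≡⟨ cong (sqfreeOver c j a′ *_) (iter-raiseᵀ-squarefreeOfDegree j c S b) ⟩
    sqfreeOver c j a′ * (κ c * (+ (S !) * sqfreeOver c (j ℕ.+ S) b))
      ≡⟨ exchange (sqfreeOver c j a′) (κ c) _ ⟩
    + (S !) * sqfreeOver c (j ℕ.+ S) b * (κ c * sqfreeOver c j a′) ∎

-- pairSum e p q j counts the factorizations x^e = x^a x^b into squarefree monomials of degrees p and q,
-- each with a choice of j variables dividing both x^a and x^b.
pairTerm : (e a c : Vec ℕ n) → ℕ → ℕ → ℕ → ℤ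
pairTerm e a c p q j = squarefreeOfDegree j c * sqfreeOver c p a * sqfreeOver c q (zipWith _∸_ e a)

pairSum : Vec ℕ n → ℕ → ℕ → ℕ → ℤ
pairSum {n} e p q j = ∑[ a ∈ divisors e ] ∑[ c ∈ allVecs (List.upTo 2) n ] pairTerm e a c p q j

coeff-lhs : ∀ n r s j → j ≤ r → (e : Vec ℕ n) →
            coeff (lhs n r s j) e ≡ + ((r ∸ j) !) * + ((r ℕ.+ s ∸ j) !) * pairSum e (r ℕ.+ s) r j
coeff-lhs n r s j j≤r e = begin
  coeff (lhs n r s j) e
    ≡⟨ coeff-diag n (iter T (Xplus n) (iter S (Yplus n) (m1xy n j))) e ⟩
  ∑[ a ∈ divisors e ] coeff (iter T (Xplus n) (iter S (Yplus n) (m1xy n j))) (a Vec.++ zipWith _∸_ e a)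
    ≡⟨ ∑-cong (divisors e) (λ a → coeff-XY-m1xy n j S T a (zipWith _∸_ e a)) ⟩
  ∑[ a ∈ divisors e ] ∑[ c ∈ V ] (+ (S !) * sqfreeOver c (j ℕ.+ S) (zipWith _∸_ e a)
                                   * (squarefreeOfDegree j c * (+ (T !) * sqfreeOver c (j ℕ.+ T) a)))
    ≡⟨ ∑-cong (divisors e) (λ a → trans (∑-cong V λ c → rearrange c a) (∑-*ˡ V K _)) ⟩
  ∑[ a ∈ divisors e ] (K * ∑[ c ∈ V ] pairTerm e a c (r ℕ.+ s) r j)
    ≡⟨ ∑-*ˡ (divisors e) K _ ⟩
  K * pairSum e (r ℕ.+ s) r j ∎
  where
  open ≡-Reasoning
  S = r ∸ j
  T = r ℕ.+ s ∸ j
  K = + (S !) * + (T !)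
  V = allVecs (List.upTo 2) n
  j+S≡r : j ℕ.+ S ≡ r
  j+S≡r = ℕₚ.m+[n∸m]≡n j≤r
  j+T≡r+s : j ℕ.+ T ≡ r ℕ.+ s
  j+T≡r+s = ℕₚ.m+[n∸m]≡n (ℕₚ.≤-trans j≤r (ℕₚ.m≤m+n r s))
  shuffle : ∀ s h k t h′ → s * h * (k * (t * h′)) ≡ s * t * (k * h′ * h)
  shuffle = solve-∀
  rearrange : ∀ c a → + (S !) * sqfreeOver c (j ℕ.+ S) (zipWith _∸_ e a)
                        * (squarefreeOfDegree j c * (+ (T !) * sqfreeOver c (j ℕ.+ T) a))
                      ≡ K * pairTerm e a c (r ℕ.+ s) r j
  rearrange c a rewrite j+S≡r | j+T≡r+s =
    shuffle (+ (S !)) (sqfreeOver c r (zipWith _∸_ e a)) (squarefreeOfDegree j c)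
            (+ (T !)) (sqfreeOver c (r ℕ.+ s) a)

-- Counting factorizations

prev : ℕ → (ℕ → ℤ) → ℤ
prev zero    f = 0ℤ
prev (suc m) f = f m

prev-cong : ∀ m {f g : ℕ → ℤ} → (∀ k → f k ≡ g k) → prev m f ≡ prev m g
prev-cong zero    f≗g = refl
prev-cong (suc m) f≗g = f≗g m

prev-+ : ∀ m (f g : ℕ → ℤ) → prev m f + prev m g ≡ prev m (λ k → f k + g k)
prev-+ zero    f g = refl
prev-+ (suc m) f g = refl

prev-zero : ∀ m {f : ℕ → ℤ} → (∀ k → k < m → f k ≡ 0ℤ) → prev m f ≡ 0ℤ
prev-zero zero    f≡0 = refl
prev-zero (suc m) f≡0 = f≡0 m ℕₚ.≤-refl

prev-+ˡ : ∀ i w (f : ℕ → ℤ) → (∀ k → k < i → f k ≡ 0ℤ) → prev (i ℕ.+ w) f ≡ prev w (λ w′ → f (i ℕ.+ w′))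
prev-+ˡ zero    zero     f f≡0 = refl
prev-+ˡ (suc i) zero     f f≡0 = f≡0 (i ℕ.+ 0) (s≤s (ℕₚ.≤-reflexive (ℕₚ.+-identityʳ i)))
prev-+ˡ i       (suc w)  f f≡0 rewrite ℕₚ.+-suc i w = refl

-- The recursion of pairSum in the first exponent: a variable with exponent 1 goes into x^a or into x^b,
-- one with exponent 2 into both, and then it may or may not be chosen.
pairCount : Vec ℕ n → ℕ → ℕ → ℕ → ℤ
pairCount []                      p q j = δ 0 j * δ p 0 * δ q 0
pairCount (zero ∷ e)              p q j = pairCount e p q j
pairCount (suc zero ∷ e)          p q j = prev q (λ q′ → pairCount e p q′ j) + prev p (λ p′ → pairCount e p′ q j)
pairCount (suc (suc zero) ∷ e)    p q j =
  prev p (λ p′ → prev q (λ q′ → pairCount e p′ q′ j + prev j (pairCount e p′ q′)))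
pairCount (suc (suc (suc _)) ∷ e) p q j = 0ℤ

slice : ℕ → (e : Vec ℕ n) → ℕ → ℕ → ℕ → ℕ → ℕ → ℤ
slice {n} x e a₀ c₀ p q j =
  ∑[ a ∈ divisors e ] ∑[ c ∈ allVecs (List.upTo 2) n ] pairTerm (x ∷ e) (a₀ ∷ a) (c₀ ∷ c) p q j

pairSum-∷ : ∀ x (e : Vec ℕ n) p q j →
            pairSum (x ∷ e) p q j ≡ ∑[ a₀ ∈ List.upTo (suc x) ] (slice x e a₀ 0 p q j + slice x e a₀ 1 p q j)
pairSum-∷ {n} x e p q j = begin
  ∑ (concatMap (λ a₀ → map (a₀ ∷_) (divisors e)) (List.upTo (suc x))) F
    ≡⟨ ∑-concatMap (λ a₀ → map (a₀ ∷_) (divisors e)) (List.upTo (suc x)) F ⟩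
  ∑[ a₀ ∈ List.upTo (suc x) ] ∑ (map (a₀ ∷_) (divisors e)) F
    ≡⟨ ∑-cong (List.upTo (suc x)) (λ a₀ → trans (∑-map (a₀ ∷_) (divisors e) F)
                                               (trans (∑-cong (divisors e) (split a₀)) (∑-+ (divisors e) _ _))) ⟩
  ∑[ a₀ ∈ List.upTo (suc x) ] (slice x e a₀ 0 p q j + slice x e a₀ 1 p q j) ∎
  where
  open ≡-Reasoning
  V = allVecs (List.upTo 2) n
  F : Vec ℕ (suc n) → ℤ
  F a = ∑[ c ∈ allVecs (List.upTo 2) (suc n) ] pairTerm (x ∷ e) a c p q j
  split : ∀ a₀ a → F (a₀ ∷ a) ≡ ∑[ c ∈ V ] pairTerm (x ∷ e) (a₀ ∷ a) (0 ∷ c) p q j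
                                + ∑[ c ∈ V ] pairTerm (x ∷ e) (a₀ ∷ a) (1 ∷ c) p q j
  split a₀ a = trans (∑-allVecs-suc (List.upTo 2) n (λ c → pairTerm (x ∷ e) (a₀ ∷ a) c p q j))
                     (cong (_+_ (∑[ c ∈ V ] pairTerm (x ∷ e) (a₀ ∷ a) (0 ∷ c) p q j)) (+-identityʳ _))

slice-zeroᵖ : ∀ x (e : Vec ℕ n) a₀ c₀ p q j →
              (∀ c a → sqfreeOver (c₀ ∷ c) p (a₀ ∷ a) ≡ 0ℤ) → slice x e a₀ c₀ p q j ≡ 0ℤ
slice-zeroᵖ {n} x e a₀ c₀ p q j H≡0 = ∑-zero (divisors e) λ a → ∑-zero (allVecs (List.upTo 2) n) λ c →
  cong (_* sqfreeOver (c₀ ∷ c) q (zipWith _∸_ (x ∷ e) (a₀ ∷ a)))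
       (trans (cong (squarefreeOfDegree j (c₀ ∷ c) *_) (H≡0 c a)) (*-zeroʳ (squarefreeOfDegree j (c₀ ∷ c))))

slice-zeroᑫ : ∀ x (e : Vec ℕ n) a₀ c₀ p q j →
              (∀ c b → sqfreeOver (c₀ ∷ c) q ((x ∸ a₀) ∷ b) ≡ 0ℤ) → slice x e a₀ c₀ p q j ≡ 0ℤ
slice-zeroᑫ {n} x e a₀ c₀ p q j H≡0 = ∑-zero (divisors e) λ a → ∑-zero (allVecs (List.upTo 2) n) λ c →
  trans (cong (squarefreeOfDegree j (c₀ ∷ c) * sqfreeOver (c₀ ∷ c) p (a₀ ∷ a) *_) (H≡0 c (zipWith _∸_ e a)))
        (*-zeroʳ (squarefreeOfDegree j (c₀ ∷ c) * sqfreeOver (c₀ ∷ c) p (a₀ ∷ a)))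

pairSum-0∷ : ∀ (e : Vec ℕ n) p q j → pairSum (0 ∷ e) p q j ≡ pairSum e p q j
pairSum-0∷ e p q j = begin
  pairSum (0 ∷ e) p q j                           ≡⟨ pairSum-∷ 0 e p q j ⟩
  (pairSum e p q j + slice 0 e 0 1 p q j) + 0ℤ    ≡⟨ +-identityʳ _ ⟩
  pairSum e p q j + slice 0 e 0 1 p q j           ≡⟨ cong (_+_ (pairSum e p q j)) (slice-zeroᵖ 0 e 0 1 p q j λ _ _ → refl) ⟩
  pairSum e p q j + 0ℤ                            ≡⟨ +-identityʳ _ ⟩
  pairSum e p q j                                 ∎
  where open ≡-Reasoning

pairSum-1∷ : ∀ (e : Vec ℕ n) p q j →
             pairSum (1 ∷ e) p q j ≡ prev q (λ q′ → pairSum e p q′ j) + prev p (λ p′ → pairSum e p′ q j)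
pairSum-1∷ e p q j = begin
  pairSum (1 ∷ e) p q j
    ≡⟨ pairSum-∷ 1 e p q j ⟩
  (slice 1 e 0 0 p q j + slice 1 e 0 1 p q j) + ((slice 1 e 1 0 p q j + slice 1 e 1 1 p q j) + 0ℤ)
    ≡⟨ cong₂ _+_ (cong₂ _+_ (into-b q) (slice-zeroᵖ 1 e 0 1 p q j λ _ _ → refl))
                 (cong (_+ 0ℤ) (cong₂ _+_ (into-a p) (slice-zeroᑫ 1 e 1 1 p q j λ _ _ → refl))) ⟩
  (inB + 0ℤ) + ((inA + 0ℤ) + 0ℤ)
    ≡⟨ cong₂ _+_ (+-identityʳ inB) (trans (+-identityʳ (inA + 0ℤ)) (+-identityʳ inA)) ⟩
  inB + inA ∎
  where
  open ≡-Reasoning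
  inB inA : ℤ
  inB = prev q (λ q′ → pairSum e p q′ j)
  inA = prev p (λ p′ → pairSum e p′ q j)
  into-b : ∀ q → slice 1 e 0 0 p q j ≡ prev q (λ q′ → pairSum e p q′ j)
  into-b zero    = slice-zeroᑫ 1 e 0 0 p 0 j λ _ _ → refl
  into-b (suc q) = refl
  into-a : ∀ p → slice 1 e 1 0 p q j ≡ prev p (λ p′ → pairSum e p′ q j)
  into-a zero    = slice-zeroᵖ 1 e 1 0 0 q j λ _ _ → refl
  into-a (suc p) = refl

pairSum-2∷ : ∀ (e : Vec ℕ n) p q j →
             pairSum (2 ∷ e) p q j ≡ prev p (λ p′ → prev q (λ q′ → pairSum e p′ q′ j + prev j (pairSum e p′ q′)))
pairSum-2∷ e p q j = begin
  pairSum (2 ∷ e) p q j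
    ≡⟨ pairSum-∷ 2 e p q j ⟩
  (slice 2 e 0 0 p q j + slice 2 e 0 1 p q j)
    + ((slice 2 e 1 0 p q j + slice 2 e 1 1 p q j) + ((slice 2 e 2 0 p q j + slice 2 e 2 1 p q j) + 0ℤ))
    ≡⟨ cong₂ _+_ (cong₂ _+_ (slice-zeroᑫ 2 e 0 0 p q j λ _ _ → refl) (slice-zeroᑫ 2 e 0 1 p q j λ _ _ → refl))
                 (cong (_+_ (slice 2 e 1 0 p q j + slice 2 e 1 1 p q j))
                       (cong (_+ 0ℤ) (cong₂ _+_ (slice-zeroᵖ 2 e 2 0 p q j λ _ _ → refl)
                                                (slice-zeroᵖ 2 e 2 1 p q j λ _ _ → refl)))) ⟩
  0ℤ + ((slice 2 e 1 0 p q j + slice 2 e 1 1 p q j) + 0ℤ)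
    ≡⟨ trans (+-identityˡ _) (+-identityʳ _) ⟩
  slice 2 e 1 0 p q j + slice 2 e 1 1 p q j
    ≡⟨ cong₂ _+_ (uncommon p q) (common p q j) ⟩
  prev p (λ p′ → prev q (λ q′ → pairSum e p′ q′ j)) + prev p (λ p′ → prev q (λ q′ → prev j (pairSum e p′ q′)))
    ≡⟨ trans (prev-+ p _ _) (prev-cong p λ p′ → prev-+ q _ _) ⟩
  prev p (λ p′ → prev q (λ q′ → pairSum e p′ q′ j + prev j (pairSum e p′ q′))) ∎
  where
  open ≡-Reasoning
  uncommon : ∀ p q → slice 2 e 1 0 p q j ≡ prev p (λ p′ → prev q (λ q′ → pairSum e p′ q′ j))
  uncommon zero    q       = slice-zeroᵖ 2 e 1 0 0 q j λ _ _ → refl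
  uncommon (suc p) zero    = slice-zeroᑫ 2 e 1 0 (suc p) 0 j λ _ _ → refl
  uncommon (suc p) (suc q) = refl
  common : ∀ p q j → slice 2 e 1 1 p q j ≡ prev p (λ p′ → prev q (λ q′ → prev j (pairSum e p′ q′)))
  common zero    q       j       = slice-zeroᵖ 2 e 1 1 0 q j λ _ _ → refl
  common (suc p) zero    j       = slice-zeroᑫ 2 e 1 1 (suc p) 0 j λ _ _ → refl
  common (suc p) (suc q) zero    = ∑-zero (divisors e) λ a → ∑-zero (allVecs (List.upTo 2) _) λ c →
    cong (λ κ → κ * sqfreeOver c p a * sqfreeOver c q (zipWith _∸_ e a)) (*-zeroʳ (allAtMost 1 c))
  common (suc p) (suc q) (suc j) = refl

pairSum-3+∷ : ∀ x (e : Vec ℕ n) p q j → pairSum (3 ℕ.+ x ∷ e) p q j ≡ 0ℤ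
pairSum-3+∷ x e p q j = trans (pairSum-∷ (3 ℕ.+ x) e p q j) (∑-zero (List.upTo (4 ℕ.+ x)) vanishes)
  where
  vanishes : ∀ a₀ → slice (3 ℕ.+ x) e a₀ 0 p q j + slice (3 ℕ.+ x) e a₀ 1 p q j ≡ 0ℤ
  vanishes zero          = cong₂ _+_ (slice-zeroᑫ (3 ℕ.+ x) e 0 0 p q j λ _ _ → refl)
                                     (slice-zeroᑫ (3 ℕ.+ x) e 0 1 p q j λ _ _ → refl)
  vanishes (suc zero)    = cong₂ _+_ (slice-zeroᑫ (3 ℕ.+ x) e 1 0 p q j λ _ _ → refl)
                                     (slice-zeroᑫ (3 ℕ.+ x) e 1 1 p q j λ _ _ → refl)
  vanishes (suc (suc y)) = cong₂ _+_ (slice-zeroᵖ (3 ℕ.+ x) e (2 ℕ.+ y) 0 p q j λ _ _ → refl)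
                                     (slice-zeroᵖ (3 ℕ.+ x) e (2 ℕ.+ y) 1 p q j λ _ _ → refl)

pairSum≡pairCount : ∀ (e : Vec ℕ n) p q j → pairSum e p q j ≡ pairCount e p q j
pairSum≡pairCount []                      p q j =
  trans (+-identityʳ _) (trans (+-identityʳ (1ℤ * δ 0 j * δ p 0 * δ q 0))
                               (cong (λ κ → κ * δ p 0 * δ q 0) (*-identityˡ (δ 0 j))))
pairSum≡pairCount (zero ∷ e)              p q j = trans (pairSum-0∷ e p q j) (pairSum≡pairCount e p q j)
pairSum≡pairCount (suc zero ∷ e)          p q j = trans (pairSum-1∷ e p q j)
  (cong₂ _+_ (prev-cong q λ q′ → pairSum≡pairCount e p q′ j) (prev-cong p λ p′ → pairSum≡pairCount e p′ q j))
pairSum≡pairCount (suc (suc zero) ∷ e)    p q j = trans (pairSum-2∷ e p q j)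
  (prev-cong p λ p′ → prev-cong q λ q′ →
     cong₂ _+_ (pairSum≡pairCount e p′ q′ j) (prev-cong j λ j′ → pairSum≡pairCount e p′ q′ j′))
pairSum≡pairCount (suc (suc (suc x)) ∷ e) p q j = pairSum-3+∷ x e p q j

pairCount-< : ∀ (e : Vec ℕ n) p q j → p < count 2 e ⊎ q < count 2 e → pairCount e p q j ≡ 0ℤ
pairCount-< []                      p q j (inj₁ ())
pairCount-< []                      p q j (inj₂ ())
pairCount-< (zero ∷ e)              p q j small = pairCount-< e p q j small
pairCount-< (suc zero ∷ e)          p q j small =
  cong₂ _+_ (prev-zero q λ q′ q′<q → pairCount-< e p q′ j (Sum.map₂ (ℕₚ.<-trans q′<q) small))
            (prev-zero p λ p′ p′<p → pairCount-< e p′ q j (Sum.map₁ (ℕₚ.<-trans p′<p) small))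
pairCount-< (suc (suc zero) ∷ e)    p q j small =
  prev-zero p λ p′ p′<p → prev-zero q λ q′ q′<q →
    cong₂ _+_ (pairCount-< e p′ q′ j (small′ p′<p q′<q))
              (prev-zero j λ j′ _ → pairCount-< e p′ q′ j′ (small′ p′<p q′<q))
  where
  small′ : ∀ {p′ q′} → p′ < p → q′ < q → p′ < count 2 e ⊎ q′ < count 2 e
  small′ p′<p q′<q = Sum.map (ℕₚ.<-≤-trans p′<p ∘ ℕ.s≤s⁻¹) (ℕₚ.<-≤-trans q′<q ∘ ℕ.s≤s⁻¹) small
pairCount-< (suc (suc (suc _)) ∷ e) p q j small = refl

pascal-split : ∀ (A : ℤ) k c u w →
  prev w (λ w′ → A * (δ k (u ℕ.+ w′) * + (c ℕ.* ((u ℕ.+ w′) C u))))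
  + prev u (λ u′ → A * (δ k (u′ ℕ.+ w) * + (c ℕ.* ((u′ ℕ.+ w) C u′))))
  ≡ A * (δ (suc k) (u ℕ.+ w) * + (c ℕ.* ((u ℕ.+ w) C u)))
pascal-split A k c zero    zero    = sym (*-zeroʳ A)
pascal-split A k c zero    (suc w) = +-identityʳ _
pascal-split A k c (suc u) zero
  rewrite ℕₚ.+-identityʳ u | nCn≡1 u | nCn≡1 (suc u) = +-identityˡ _
pascal-split A k c (suc u) (suc w) rewrite ℕₚ.+-suc u w = begin
  A * (δ k (suc N) * + (c ℕ.* (suc N C suc u))) + A * (δ k (suc N) * + (c ℕ.* (suc N C u)))
    ≡⟨ combine A (δ k (suc N)) (+ (c ℕ.* (suc N C suc u))) (+ (c ℕ.* (suc N C u))) ⟩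
  A * (δ k (suc N) * (+ (c ℕ.* (suc N C u)) + + (c ℕ.* (suc N C suc u))))
    ≡⟨ cong (λ z → A * (δ k (suc N) * z)) (sym (pos-+ (c ℕ.* (suc N C u)) _)) ⟩
  A * (δ k (suc N) * + (c ℕ.* (suc N C u) ℕ.+ c ℕ.* (suc N C suc u)))
    ≡⟨ cong (λ z → A * (δ k (suc N) * + z))
            (trans (sym (ℕₚ.*-distribˡ-+ c (suc N C u) _)) (cong (c ℕ.*_) (nCk+nC[k+1]≡[n+1]C[k+1] (suc N) u))) ⟩
  A * (δ k (suc N) * + (c ℕ.* (suc (suc N) C suc u))) ∎
  where
  open ≡-Reasoning
  N = u ℕ.+ w
  combine : ∀ a d x y → a * (d * x) + a * (d * y) ≡ a * (d * (y + x))
  combine = solve-∀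

pascal-choose : ∀ (A d : ℤ) i j m →
  A * (d * + ((i C j) ℕ.* m)) + prev j (λ j′ → A * (d * + ((i C j′) ℕ.* m)))
  ≡ A * (d * + ((suc i C j) ℕ.* m))
pascal-choose A d i zero    m = +-identityʳ _
pascal-choose A d i (suc j) m = begin
  A * (d * + ((i C suc j) ℕ.* m)) + A * (d * + ((i C j) ℕ.* m))
    ≡⟨ combine A d (+ ((i C suc j) ℕ.* m)) (+ ((i C j) ℕ.* m)) ⟩
  A * (d * (+ ((i C j) ℕ.* m) + + ((i C suc j) ℕ.* m)))
    ≡⟨ cong (λ z → A * (d * z)) (sym (pos-+ ((i C j) ℕ.* m) _)) ⟩
  A * (d * + ((i C j) ℕ.* m ℕ.+ (i C suc j) ℕ.* m))
    ≡⟨ cong (λ z → A * (d * + z))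
            (trans (sym (ℕₚ.*-distribʳ-+ m (i C j) _)) (cong (ℕ._* m) (nCk+nC[k+1]≡[n+1]C[k+1] i j))) ⟩
  A * (d * + ((suc i C suc j) ℕ.* m)) ∎
  where
  open ≡-Reasoning
  combine : ∀ a d x y → a * (d * x) + a * (d * y) ≡ a * (d * (y + x))
  combine = solve-∀

pairCount-closed : ∀ (e : Vec ℕ n) u w j →
  pairCount e (count 2 e ℕ.+ u) (count 2 e ℕ.+ w) j
  ≡ allAtMost 2 e * (δ (count 1 e) (u ℕ.+ w) * + ((count 2 e C j) ℕ.* ((u ℕ.+ w) C u)))
pairCount-closed []      zero    zero    zero    = refl
pairCount-closed []      zero    zero    (suc j) = refl
pairCount-closed []      zero    (suc w) j       = *-zeroʳ (δ 0 j * 1ℤ)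
pairCount-closed []      (suc u) w       j       = cong (_* δ w 0) (*-zeroʳ (δ 0 j))
pairCount-closed (zero ∷ e) u w j = pairCount-closed e u w j
pairCount-closed (suc zero ∷ e) u w j = begin
  prev (twos ℕ.+ w) (λ q′ → pairCount e (twos ℕ.+ u) q′ j) + prev (twos ℕ.+ u) (λ p′ → pairCount e p′ (twos ℕ.+ w) j)
    ≡⟨ cong₂ _+_ (prev-+ˡ twos w _ λ q′ q′<twos → pairCount-< e (twos ℕ.+ u) q′ j (inj₂ q′<twos))
                 (prev-+ˡ twos u _ λ p′ p′<twos → pairCount-< e p′ (twos ℕ.+ w) j (inj₁ p′<twos)) ⟩
  prev w (λ w′ → pairCount e (twos ℕ.+ u) (twos ℕ.+ w′) j) + prev u (λ u′ → pairCount e (twos ℕ.+ u′) (twos ℕ.+ w) j)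
    ≡⟨ cong₂ _+_ (prev-cong w λ w′ → pairCount-closed e u w′ j) (prev-cong u λ u′ → pairCount-closed e u′ w j) ⟩
  prev w (λ w′ → allAtMost 2 e * (δ ones (u ℕ.+ w′) * + ((twos C j) ℕ.* ((u ℕ.+ w′) C u))))
  + prev u (λ u′ → allAtMost 2 e * (δ ones (u′ ℕ.+ w) * + ((twos C j) ℕ.* ((u′ ℕ.+ w) C u′))))
    ≡⟨ pascal-split (allAtMost 2 e) ones (twos C j) u w ⟩
  allAtMost 2 e * (δ (suc ones) (u ℕ.+ w) * + ((twos C j) ℕ.* ((u ℕ.+ w) C u))) ∎
  where
  open ≡-Reasoning
  twos = count 2 e
  ones = count 1 e
pairCount-closed (suc (suc zero) ∷ e) u w j =
  trans (cong₂ _+_ (pairCount-closed e u w j) (prev-cong j λ j′ → pairCount-closed e u w j′))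
        (pascal-choose (allAtMost 2 e) (δ (count 1 e) (u ℕ.+ w)) (count 2 e) j ((u ℕ.+ w) C u))
pairCount-closed (suc (suc (suc _)) ∷ e) u w j = refl

coeff-m21 : ∀ n i k (e : Vec ℕ n) →
            coeff (m21 n i k) e ≡ allAtMost 2 e * (δ (count 2 e) i * δ (count 1 e) k)
coeff-m21 n i k e = begin
  coeff (m21 n i k) e
    ≡⟨ trans (coeff-∑ (m21 n i k) e) (∑-map _ (filter P? (allVecs V n)) _) ⟩
  ∑[ x ∈ filter P? (allVecs V n) ] (δᵛ x e * 1ℤ)
    ≡⟨ ∑-filter P? (allVecs V n) _ ⟩
  ∑[ x ∈ allVecs V n ] (𝟙 (P? x) * (δᵛ x e * 1ℤ))
    ≡⟨ ∑-cong (allVecs V n) (λ x → begin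
         𝟙 (P? x) * (δᵛ x e * 1ℤ)
           ≡⟨ cong₂ _*_ (trans (𝟙-×-dec (count 2 x ℕ.≟ i) (count 1 x ℕ.≟ k))
                               (cong₂ _*_ (𝟙-≟ (count 2 x) i) (𝟙-≟ (count 1 x) k)))
                        (*-identityʳ (δᵛ x e)) ⟩
         δ (count 2 x) i * δ (count 1 x) k * δᵛ x e
           ≡⟨ *-comm _ (δᵛ x e) ⟩
         δᵛ x e * (δ (count 2 x) i * δ (count 1 x) k) ∎) ⟩
  ∑[ x ∈ allVecs V n ] (δᵛ x e * (δ (count 2 x) i * δ (count 1 x) k))
    ≡⟨ ∑-allVecs-δᵛ 2 n e (λ x → δ (count 2 x) i * δ (count 1 x) k) ⟩
  allAtMost 2 e * (δ (count 2 e) i * δ (count 1 e) k) ∎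
  where
  open ≡-Reasoning
  V = List.upTo 3
  P? : (x : Vec ℕ n) → Dec (count 2 x ≡ i × count 1 x ≡ k)
  P? x = (count 2 x ℕ.≟ i) ×-dec (count 1 x ℕ.≟ k)

rhsCoeff : ℕ → ℕ → ℕ → ℕ → ℕ
rhsCoeff r s j i = (i C j) ℕ.* ((2 ℕ.* (r ∸ i) ℕ.+ s) C (r ∸ i)) ℕ.* (r ∸ j) ! ℕ.* ((r ℕ.+ s) ∸ j) !

rhsTerm : ℕ → ℕ → ℕ → Vec ℕ n → ℕ → ℤ
rhsTerm r s j e t =
  + rhsCoeff r s j (j ℕ.+ t) * (allAtMost 2 e * (δ (count 2 e) (j ℕ.+ t) * δ (count 1 e) (2 ℕ.* (r ∸ (j ℕ.+ t)) ℕ.+ s)))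

rhsTerm-off : ∀ r s j (e : Vec ℕ n) t → count 2 e ≢ j ℕ.+ t → rhsTerm r s j e t ≡ 0ℤ
rhsTerm-off r s j e t i≢j+t = begin
  K * (allAtMost 2 e * (δ (count 2 e) (j ℕ.+ t) * D)) ≡⟨ cong (λ d → K * (allAtMost 2 e * (d * D))) (δ-≢ i≢j+t) ⟩
  K * (allAtMost 2 e * 0ℤ)                             ≡⟨ cong (K *_) (*-zeroʳ (allAtMost 2 e)) ⟩
  K * 0ℤ                                               ≡⟨ *-zeroʳ K ⟩
  0ℤ                                                   ∎
  where
  open ≡-Reasoning
  K = + rhsCoeff r s j (j ℕ.+ t)
  D = δ (count 1 e) (2 ℕ.* (r ∸ (j ℕ.+ t)) ℕ.+ s)

coeff-rhs : ∀ n r s j (e : Vec ℕ n) → coeff (rhs n r s j) e ≡ ∑ (List.upTo (suc (r ∸ j))) (rhsTerm r s j e)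
coeff-rhs n r s j e =
  trans (coeff-concatMap term (List.upTo (suc (r ∸ j))) e) (∑-cong (List.upTo (suc (r ∸ j))) λ t →
    trans (coeff-scale (+ rhsCoeff r s j (j ℕ.+ t)) (m21 n (j ℕ.+ t) (ones t)) e)
          (cong (+ rhsCoeff r s j (j ℕ.+ t) *_) (coeff-m21 n (j ℕ.+ t) (ones t) e)))
  where
  ones : ℕ → ℕ
  ones t = 2 ℕ.* (r ∸ (j ℕ.+ t)) ℕ.+ s
  term : ℕ → Poly n
  term t = scale (+ rhsCoeff r s j (j ℕ.+ t)) (m21 n (j ℕ.+ t) (ones t))

closedCoeff : ℕ → ℕ → ℕ → Vec ℕ n → ℤ
closedCoeff r s j e =
  + ((r ∸ j) !) * + ((r ℕ.+ s ∸ j) !)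
  * (allAtMost 2 e * (δ (count 1 e) (2 ℕ.* w ℕ.+ s) * + ((count 2 e C j) ℕ.* ((2 ℕ.* w ℕ.+ s) C w))))
  where w = r ∸ count 2 e

closedCoeff-vanishes : ∀ r s j (e : Vec ℕ n) → count 2 e < j → closedCoeff r s j e ≡ 0ℤ
closedCoeff-vanishes r s j e i<j rewrite k>n⇒nCk≡0 i<j = begin
  K * (allAtMost 2 e * (D * 0ℤ))  ≡⟨ cong (λ z → K * (allAtMost 2 e * z)) (*-zeroʳ D) ⟩
  K * (allAtMost 2 e * 0ℤ)        ≡⟨ cong (K *_) (*-zeroʳ (allAtMost 2 e)) ⟩
  K * 0ℤ                          ≡⟨ *-zeroʳ K ⟩
  0ℤ                              ∎
  where
  open ≡-Reasoning
  K = + ((r ∸ j) !) * + ((r ℕ.+ s ∸ j) !)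
  D = δ (count 1 e) (2 ℕ.* (r ∸ count 2 e) ℕ.+ s)

coeff-lhs-vanishes : ∀ n r s j → j ≤ r → (e : Vec ℕ n) → r < count 2 e → coeff (lhs n r s j) e ≡ 0ℤ
coeff-lhs-vanishes n r s j j≤r e r<i = begin
  coeff (lhs n r s j) e                          ≡⟨ coeff-lhs n r s j j≤r e ⟩
  K * pairSum e (r ℕ.+ s) r j                    ≡⟨ cong (K *_) (pairSum≡pairCount e (r ℕ.+ s) r j) ⟩
  K * pairCount e (r ℕ.+ s) r j                  ≡⟨ cong (K *_) (pairCount-< e (r ℕ.+ s) r j (inj₂ r<i)) ⟩
  K * 0ℤ                                         ≡⟨ *-zeroʳ K ⟩
  0ℤ                                             ∎
  where
  open ≡-Reasoning
  K = + ((r ∸ j) !) * + ((r ℕ.+ s ∸ j) !)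

coeff-lhs-closed : ∀ n r s j → j ≤ r → (e : Vec ℕ n) → count 2 e ≤ r →
                   coeff (lhs n r s j) e ≡ closedCoeff r s j e
coeff-lhs-closed n r s j j≤r e i≤r = begin
  coeff (lhs n r s j) e
    ≡⟨ trans (coeff-lhs n r s j j≤r e) (cong (K *_) (pairSum≡pairCount e (r ℕ.+ s) r j)) ⟩
  K * pairCount e (r ℕ.+ s) r j
    ≡⟨ cong₂ (λ p q → K * pairCount e p q j) (sym i+[w+s]≡r+s) (sym i+w≡r) ⟩
  K * pairCount e (i ℕ.+ (w ℕ.+ s)) (i ℕ.+ w) j
    ≡⟨ cong (K *_) (pairCount-closed e (w ℕ.+ s) w j) ⟩
  K * (allAtMost 2 e * (δ (count 1 e) (w ℕ.+ s ℕ.+ w) * + ((i C j) ℕ.* ((w ℕ.+ s ℕ.+ w) C (w ℕ.+ s)))))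
    ≡⟨ cong (λ z → K * (allAtMost 2 e * (δ (count 1 e) (w ℕ.+ s ℕ.+ w) * + ((i C j) ℕ.* z)))) choose-sym ⟩
  K * (allAtMost 2 e * (δ (count 1 e) (w ℕ.+ s ℕ.+ w) * + ((i C j) ℕ.* ((w ℕ.+ s ℕ.+ w) C w))))
    ≡⟨ cong (λ m → K * (allAtMost 2 e * (δ (count 1 e) m * + ((i C j) ℕ.* (m C w))))) (ℕₚ.+-comm (w ℕ.+ s) w) ⟩
  K * (allAtMost 2 e * (δ (count 1 e) (w ℕ.+ (w ℕ.+ s)) * + ((i C j) ℕ.* ((w ℕ.+ (w ℕ.+ s)) C w))))
    ≡⟨ cong (λ m → K * (allAtMost 2 e * (δ (count 1 e) m * + ((i C j) ℕ.* (m C w))))) w+[w+s]≡2w+s ⟩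
  closedCoeff r s j e ∎
  where
  open ≡-Reasoning
  K = + ((r ∸ j) !) * + ((r ℕ.+ s ∸ j) !)
  i = count 2 e
  w = r ∸ i
  i+w≡r : i ℕ.+ w ≡ r
  i+w≡r = ℕₚ.m+[n∸m]≡n i≤r
  i+[w+s]≡r+s : i ℕ.+ (w ℕ.+ s) ≡ r ℕ.+ s
  i+[w+s]≡r+s = trans (sym (ℕₚ.+-assoc i w s)) (cong (ℕ._+ s) i+w≡r)
  w+[w+s]≡2w+s : w ℕ.+ (w ℕ.+ s) ≡ 2 ℕ.* w ℕ.+ s
  w+[w+s]≡2w+s = trans (sym (ℕₚ.+-assoc w w s)) (cong (λ z → w ℕ.+ z ℕ.+ s) (sym (ℕₚ.+-identityʳ w)))
  choose-sym : (w ℕ.+ s ℕ.+ w) C (w ℕ.+ s) ≡ (w ℕ.+ s ℕ.+ w) C w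
  choose-sym = trans (nCk≡nC[n∸k] (ℕₚ.m≤m+n (w ℕ.+ s) w)) (cong ((w ℕ.+ s ℕ.+ w) C_) (ℕₚ.m+n∸m≡n (w ℕ.+ s) w))

coeff-rhs-vanishes : ∀ n r s j (e : Vec ℕ n) → (∀ t → t < suc (r ∸ j) → count 2 e ≢ j ℕ.+ t) →
                     coeff (rhs n r s j) e ≡ 0ℤ
coeff-rhs-vanishes n r s j e i≢j+t =
  trans (coeff-rhs n r s j e) (∑-upTo-zero (suc (r ∸ j)) (rhsTerm r s j e) λ t t<1+r-j →
    rhsTerm-off r s j e t (i≢j+t t t<1+r-j))

coeff-rhs-closed : ∀ n r s j (e : Vec ℕ n) → j ≤ count 2 e → count 2 e ≤ r →
                   coeff (rhs n r s j) e ≡ closedCoeff r s j e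
coeff-rhs-closed n r s j e j≤i i≤r = begin
  coeff (rhs n r s j) e
    ≡⟨ coeff-rhs n r s j e ⟩
  ∑ (List.upTo (suc (r ∸ j))) (rhsTerm r s j e)
    ≡⟨ ∑-upTo-single (suc (r ∸ j)) (rhsTerm r s j e) (i ∸ j) (s≤s (ℕₚ.∸-monoˡ-≤ j i≤r)) off-diagonal ⟩
  rhsTerm r s j e (i ∸ j)
    ≡⟨ cong (λ m → + rhsCoeff r s j m * (allAtMost 2 e * (δ i m * δ (count 1 e) (2 ℕ.* (r ∸ m) ℕ.+ s))))
            (ℕₚ.m+[n∸m]≡n j≤i) ⟩
  + rhsCoeff r s j i * (allAtMost 2 e * (δ i i * D))
    ≡⟨ cong (λ d → + rhsCoeff r s j i * (allAtMost 2 e * (d * D))) (δ-refl i) ⟩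
  + rhsCoeff r s j i * (allAtMost 2 e * (1ℤ * D))
    ≡⟨ cong (_* (allAtMost 2 e * (1ℤ * D))) (pos-*⁴ (i C j) C₂ ((r ∸ j) !) ((r ℕ.+ s ∸ j) !)) ⟩
  + (i C j) * + C₂ * + ((r ∸ j) !) * + ((r ℕ.+ s ∸ j) !) * (allAtMost 2 e * (1ℤ * D))
    ≡⟨ rearrange (+ (i C j)) (+ C₂) (+ ((r ∸ j) !)) (+ ((r ℕ.+ s ∸ j) !)) (allAtMost 2 e) D ⟩
  + ((r ∸ j) !) * + ((r ℕ.+ s ∸ j) !) * (allAtMost 2 e * (D * (+ (i C j) * + C₂)))
    ≡⟨ cong (λ z → + ((r ∸ j) !) * + ((r ℕ.+ s ∸ j) !) * (allAtMost 2 e * (D * z))) (sym (pos-* (i C j) C₂)) ⟩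
  closedCoeff r s j e ∎
  where
  open ≡-Reasoning
  i = count 2 e
  D = δ (count 1 e) (2 ℕ.* (r ∸ i) ℕ.+ s)
  C₂ = (2 ℕ.* (r ∸ i) ℕ.+ s) C (r ∸ i)
  off-diagonal : ∀ t → t < suc (r ∸ j) → t ≢ i ∸ j → rhsTerm r s j e t ≡ 0ℤ
  off-diagonal t _ t≢i-j =
    rhsTerm-off r s j e t λ i≡j+t → t≢i-j (trans (sym (ℕₚ.m+n∸m≡n j t)) (cong (_∸ j) (sym i≡j+t)))
  pos-*⁴ : ∀ a b c d → + (a ℕ.* b ℕ.* c ℕ.* d) ≡ + a * + b * + c * + d
  pos-*⁴ a b c d =
    trans (pos-* (a ℕ.* b ℕ.* c) d) (cong (_* + d) (trans (pos-* (a ℕ.* b) c) (cong (_* + c) (pos-* a b))))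
  rearrange : ∀ a b x y m d → a * b * x * y * (m * (1ℤ * d)) ≡ x * y * (m * (d * (a * b)))
  rearrange = solve-∀

+-bounded : ∀ {j r t} → j ≤ r → t < suc (r ∸ j) → j ℕ.+ t ≤ r
+-bounded {j} j≤r (s≤s t≤r-j) = ℕₚ.≤-trans (ℕₚ.+-monoʳ-≤ j t≤r-j) (ℕₚ.≤-reflexive (ℕₚ.m+[n∸m]≡n j≤r))

lemma4p5 : (r s j : ℕ) → j ≤ r → (n : ℕ) → lhs n r s j ≈P rhs n r s j
lemma4p5 r s j j≤r n e with ℕₚ.≤-<-connex (count 2 e) r
... | inj₂ r<i = trans (coeff-lhs-vanishes n r s j j≤r e r<i) (sym (coeff-rhs-vanishes n r s j e
      λ t t<1+r-j i≡j+t → ℕₚ.<⇒≱ r<i (subst (_≤ r) (sym i≡j+t) (+-bounded j≤r t<1+r-j))))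
... | inj₁ i≤r with j ℕ.≤? count 2 e
...   | yes j≤i = trans (coeff-lhs-closed n r s j j≤r e i≤r) (sym (coeff-rhs-closed n r s j e j≤i i≤r))
...   | no  j≰i = trans (coeff-lhs-closed n r s j j≤r e i≤r) (trans (closedCoeff-vanishes r s j e (ℕₚ.≰⇒> j≰i))
      (sym (coeff-rhs-vanishes n r s j e λ t _ i≡j+t → j≰i (subst (j ≤_) (sym i≡j+t) (ℕₚ.m≤m+n j t)))))
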